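{- For every $k\in\mathbb{C}$, the formal power series $\Theta_k$ satisfies $$\mathfrak{T}^2\Theta_k(x)=\frac{\Theta_k(2x)}{2},$$ where $\mathfrak{T}^2=\mathfrak{T}\circ\mathfrak{T}$.
   Context: Let $x+x^2\mathbb{C}[[x]]$ denote the set of formal power series with zero constant term and linear coefficient $1$. For $f$ in this set, $\mathfrak{T}f:=f/f'$ (again an element of $x+x^2\mathbb{C}[[x]]$), and $f^{inv}$ denotes the compositional inverse of $f$. For $k\in\mathbb{C}$, $\Theta_k\in x+x^2\mathbb{C}[[x]]$ (the Jacobi elliptic function $\mathrm{sn}$) is defined by $$\Theta_k^{inv}(x)=\int_0^x\frac{dt}{\sqrt{1-t^2}\sqrt{1-k^2t^2}},$$ the integrand being expanded as a formal power series in $t$ via the binomial series. -}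

module Defs where

open import Algebra.Bundles using (CommutativeRing)
open import Data.Nat using (ℕ; zero; suc; _∸_)
open import Data.List using (List; []; _∷_; map; zipWith; foldr; upTo)
open import Data.Maybe using (Maybe; just; nothing)
import Data.Maybe as Maybe
open import Function using (_∘_)

module PowerSeries {c ℓ} (R : CommutativeRing c ℓ) where
  open CommutativeRing R hiding (zero)

  Series : Set c
  Series = ℕ → Carrier

  _≈ₛ_ : Series → Series → Set ℓ
  f ≈ₛ g = ∀ n → f n ≈ g n

  Σ< : ℕ → (ℕ → Carrier) → Carrier
  Σ< zero    h = 0#
  Σ< (suc n) h = Σ< n h + h n

  Π< : ℕ → (ℕ → Carrier) → Carrier
  Π< zero    h = 1#
  Π< (suc n) h = Π< n h * h n

  fromℕ : ℕ → Carrier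
  fromℕ zero    = 0#
  fromℕ (suc n) = 1# + fromℕ n

  powR : Carrier → ℕ → Carrier
  powR x zero    = 1#
  powR x (suc n) = x * powR x n

  one : Series
  one zero    = 1#
  one (suc _) = 0#

  X : Series
  X (suc zero) = 1#
  X _          = 0#

  _*ₛ_ : Series → Series → Series
  (f *ₛ g) n = Σ< (suc n) (λ i → f i * g (n ∸ i))

  powₛ : Series → ℕ → Series
  powₛ f zero    = one
  powₛ f (suc j) = f *ₛ powₛ f j

  -- composition f ∘ g (meaningful for g with zero constant term):
  -- coefficient n is  Σ_{j ≤ n} f_j [x^n] g^j
  compose : Series → Series → Series
  compose f g n = Σ< (suc n) (λ j → f j * powₛ g j n)

  deriv : Series → Series
  deriv f n = fromℕ (suc n) * f (suc n)

  -- multiplicative inverse of a series with constant term 1: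
  -- b_0 = 1, b_n = - Σ_{i=1}^{n} a_i b_{n-i}.
  -- recip-list a n is the list [b_n, b_{n-1}, ..., b_0].
  recip-list : Series → ℕ → List Carrier
  recip-list a zero    = 1# ∷ []
  recip-list a (suc n) =
    (- foldr _+_ 0# (zipWith _*_ (map (a ∘ suc) (upTo (suc n))) prev)) ∷ prev
    where prev = recip-list a n

  headOr0 : List Carrier → Carrier
  headOr0 []      = 0#
  headOr0 (x ∷ _) = x

  recip : Series → Series
  recip a n = headOr0 (recip-list a n)

  -- f / g for g with constant term 1
  _/ₛ_ : Series → Series → Series
  f /ₛ g = f *ₛ recip g

  -- 𝔗 f = f / f'  (for f ∈ x + x² R[[x]], f' has constant term 1)
  𝔗 : Series → Series
  𝔗 f = f /ₛ deriv f

  Normalized : Series → Set ℓ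
  Normalized f = (f 0 ≈ 0#) × (f 1 ≈ 1#)
    where open import Data.Product using (_×_)

  IsCompInverse : Series → Series → Set ℓ
  IsCompInverse g f = (compose f g ≈ₛ X) × (compose g f ≈ₛ X)
    where open import Data.Product using (_×_)

-- R is a Q-algebra: inv n is an inverse of n+1 in R.
module _ {c ℓ} (R : CommutativeRing c ℓ) where
  open CommutativeRing R hiding (zero)
  open PowerSeries R

  IsNatInverse : (ℕ → Carrier) → Set ℓ
  IsNatInverse inv = ∀ n → fromℕ (suc n) * inv n ≈ 1#

module RatSeries {c ℓ} (R : CommutativeRing c ℓ) (inv : ℕ → CommutativeRing.Carrier R) where
  open CommutativeRing R hiding (zero)
  open PowerSeries R

  integral : Series → Series
  integral h zero    = 0#
  integral h (suc n) = inv n * h n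

  gbinom : Carrier → ℕ → Carrier
  gbinom α n = Π< n (λ i → α - fromℕ i) * Π< n inv

  evenHalf : ℕ → Maybe ℕ
  evenHalf zero          = just zero
  evenHalf (suc zero)    = nothing
  evenHalf (suc (suc n)) = Maybe.map suc (evenHalf n)

  -- binomial series of (1 - c t²)^(-1/2) = Σ_n binom(-1/2, n) (-c t²)^n
  invSqrtSeries : Carrier → Series
  invSqrtSeries a m with evenHalf m
  ... | just n  = gbinom (- inv 1) n * powR (- a) n
  ... | nothing = 0#

  -- Θ_k^{inv}(x) = ∫_0^x dt / (√(1-t²) √(1-k²t²))
  ThetaInv : Carrier → Series
  ThetaInv k = integral (invSqrtSeries 1# *ₛ invSqrtSeries (k * k))

  IsTheta : Carrier → Series → Set ℓ
  IsTheta k Θ = Normalized Θ × IsCompInverse (ThetaInv k) Θ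
    where open import Data.Product using (_×_)

  -- x ↦ f(2x)/2
  halfDilate : Series → Series
  halfDilate f n = inv 1 * (powR (1# + 1#) n * f n)

module Submission where

-- Write Θ' = Q, Rad(a) = 1 - a Θ² and D = 1 - k² Θ⁴.  Since Θ⁻¹ has
-- derivative (1 - x²)^(-1/2) (1 - k²x²)^(-1/2), the chain rule applied to
-- Θ⁻¹ ∘ Θ = x gives Q² = Rad(1) Rad(k²) and, differentiating,
-- Q' = -(1+k²) Θ + 2 k² Θ³.  A direct computation with these two identities
-- gives (𝔗 Θ)' Q² = D, hence 𝔗 (𝔗 Θ) = Θ Q / D.  The series K = 2 Θ Q / D
-- satisfies K(0) = 0, K'(0) = 2 and K'² = 4 (1 - K²)(1 - k² K²) (the
-- duplication identity for sn), so (Θ⁻¹ ∘ K)' squares to 4 and, having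
-- constant term 2, equals 2.  Thus Θ⁻¹ ∘ K = 2x = Θ⁻¹ ∘ Θ(2x), so K = Θ(2x)
-- and 𝔗 (𝔗 Θ) = K / 2 = Θ(2x) / 2.

open import Defs
open import Algebra.Bundles using (CommutativeRing; RawRing)
open import Data.Nat as ℕ using (ℕ; zero; suc; _∸_; _≤_; _<_; z≤n; s≤s)
import Data.Nat.Properties as ℕP
open import Data.Integer as ℤ using (ℤ; +_; -[1+_]; _⊖_; sign; ∣_∣; _◃_)
open import Data.Product using (_,_; proj₁; proj₂)
open import Data.Sum using (inj₁; inj₂)
open import Function using (_∘_)
open import Relation.Binary.PropositionalEquality as P using (_≡_)

-- A ring solver for an arbitrary commutative ring whose constants are
-- integers, obtained from the canonical homomorphism ℤ → R.  (The solvers of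
-- the library either need decidable equality on R or have no negation.)
module IntegerSolver {c ℓ} (CR : CommutativeRing c ℓ) where
  open CommutativeRing CR
  open import Algebra.Properties.Ring ring using (-1*x≈-x; -‿distribʳ-*)
  open import Algebra.Properties.AbelianGroup +-abelianGroup using (ε⁻¹≈ε; ⁻¹-involutive; ⁻¹-∙-comm)
  open import Relation.Binary.Reasoning.Setoid setoid
  open import Data.Sign as Sign using (Sign)
  open import Data.Maybe using (Maybe; just; nothing)
  open import Relation.Nullary using (yes; no)
  import Data.Integer.Properties as ℤP
  import Algebra.Solver.Ring.AlmostCommutativeRing as ACR

  -- the image of a natural number; the first two clauses make the
  -- numerals 0 and 1 compute to 0# and 1# on the nose
  natR : ℕ → Carrier
  natR zero = 0#
  natR (suc zero) = 1#
  natR (suc (suc n)) = 1# + natR (suc n)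

  natR-suc : ∀ n → natR (suc n) ≈ 1# + natR n
  natR-suc zero = sym (+-identityʳ _)
  natR-suc (suc n) = refl

  natR-+ : ∀ m n → natR (m ℕ.+ n) ≈ natR m + natR n
  natR-+ zero n = sym (+-identityˡ _)
  natR-+ (suc m) n = begin
    natR (suc (m ℕ.+ n))    ≈⟨ natR-suc (m ℕ.+ n) ⟩
    1# + natR (m ℕ.+ n)     ≈⟨ +-congˡ (natR-+ m n) ⟩
    1# + (natR m + natR n)  ≈⟨ sym (+-assoc _ _ _) ⟩
    (1# + natR m) + natR n  ≈⟨ +-congʳ (sym (natR-suc m)) ⟩
    natR (suc m) + natR n   ∎

  natR-* : ∀ m n → natR (m ℕ.* n) ≈ natR m * natR n
  natR-* zero n = sym (zeroˡ _)
  natR-* (suc m) n = begin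
    natR (n ℕ.+ m ℕ.* n)        ≈⟨ natR-+ n (m ℕ.* n) ⟩
    natR n + natR (m ℕ.* n)     ≈⟨ +-cong (sym (*-identityˡ _)) (natR-* m n) ⟩
    1# * natR n + natR m * natR n ≈⟨ sym (distribʳ _ _ _) ⟩
    (1# + natR m) * natR n      ≈⟨ *-congʳ (sym (natR-suc m)) ⟩
    natR (suc m) * natR n       ∎

  intR : ℤ → Carrier
  intR (+ n) = natR n
  intR -[1+ n ] = - natR (suc n)

  intR-neg : ∀ z → intR (ℤ.- z) ≈ - intR z
  intR-neg (+ zero) = sym ε⁻¹≈ε
  intR-neg (+ suc n) = refl
  intR-neg -[1+ n ] = sym (⁻¹-involutive _)

  intR-⊖ : ∀ m n → intR (m ⊖ n) ≈ natR m - natR n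
  intR-⊖ m zero = begin
    intR (m ⊖ 0)   ≈⟨ reflexive (P.cong intR (ℤP.⊖-≥ {m} {0} z≤n)) ⟩
    natR m         ≈⟨ sym (+-identityʳ _) ⟩
    natR m + 0#    ≈⟨ +-congˡ (sym ε⁻¹≈ε) ⟩
    natR m - 0#    ∎
  intR-⊖ zero (suc n) = sym (+-identityˡ _)
  intR-⊖ (suc m) (suc n) = begin
    intR (suc m ⊖ suc n)             ≈⟨ reflexive (P.cong intR (ℤP.[1+m]⊖[1+n]≡m⊖n m n)) ⟩
    intR (m ⊖ n)                     ≈⟨ intR-⊖ m n ⟩
    natR m - natR n                  ≈⟨ shift ⟩
    (1# + natR m) - (1# + natR n)    ≈⟨ sym (+-cong (natR-suc m) (-‿cong (natR-suc n))) ⟩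
    natR (suc m) - natR (suc n)      ∎
    where
    shift : natR m - natR n ≈ (1# + natR m) - (1# + natR n)
    shift = begin
      natR m - natR n                   ≈⟨ sym (+-identityˡ _) ⟩
      0# + (natR m - natR n)            ≈⟨ +-congʳ (sym (-‿inverseʳ 1#)) ⟩
      (1# - 1#) + (natR m - natR n)     ≈⟨ +-assoc _ _ _ ⟩
      1# + (- 1# + (natR m - natR n))   ≈⟨ +-congˡ (trans (sym (+-assoc _ _ _)) (trans (+-congʳ (+-comm _ _)) (+-assoc _ _ _))) ⟩
      1# + (natR m + (- 1# - natR n))   ≈⟨ sym (+-assoc _ _ _) ⟩
      (1# + natR m) + (- 1# - natR n)   ≈⟨ +-congˡ (⁻¹-∙-comm _ _) ⟩
      (1# + natR m) - (1# + natR n)     ∎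

  intR-+ : ∀ x y → intR (x ℤ.+ y) ≈ intR x + intR y
  intR-+ (+ m) (+ n) = natR-+ m n
  intR-+ (+ m) -[1+ n ] = intR-⊖ m (suc n)
  intR-+ -[1+ m ] (+ n) = trans (intR-⊖ n (suc m)) (+-comm _ _)
  intR-+ -[1+ m ] -[1+ n ] = begin
    - natR (suc (suc (m ℕ.+ n)))        ≈⟨ -‿cong (natR-suc (suc (m ℕ.+ n))) ⟩
    - (1# + natR (suc (m ℕ.+ n)))       ≈⟨ -‿cong (+-congˡ (trans (reflexive (P.cong natR (P.sym (ℕP.+-suc m n)))) (natR-+ m (suc n)))) ⟩
    - (1# + (natR m + natR (suc n)))    ≈⟨ -‿cong (sym (+-assoc _ _ _)) ⟩
    - ((1# + natR m) + natR (suc n))    ≈⟨ -‿cong (+-congʳ (sym (natR-suc m))) ⟩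
    - (natR (suc m) + natR (suc n))     ≈⟨ sym (⁻¹-∙-comm _ _) ⟩
    - natR (suc m) - natR (suc n)       ∎

  signR : Sign → Carrier
  signR Sign.+ = 1#
  signR Sign.- = - 1#

  signR-* : ∀ s t → signR (s Sign.* t) ≈ signR s * signR t
  signR-* Sign.+ t = sym (*-identityˡ _)
  signR-* Sign.- Sign.+ = sym (*-identityʳ _)
  signR-* Sign.- Sign.- = begin
    1#              ≈⟨ sym (⁻¹-involutive _) ⟩
    - (- 1#)        ≈⟨ -‿cong (sym (-1*x≈-x 1#)) ⟩
    - (- 1# * 1#)   ≈⟨ -‿distribʳ-* _ _ ⟩
    - 1# * - 1#     ∎

  intR-◃ : ∀ s n → intR (s ◃ n) ≈ signR s * natR n
  intR-◃ s zero = sym (zeroʳ _)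
  intR-◃ Sign.+ (suc n) = sym (*-identityˡ _)
  intR-◃ Sign.- (suc n) = sym (-1*x≈-x _)

  intR-signAbs : ∀ z → intR z ≈ signR (sign z) * natR ∣ z ∣
  intR-signAbs z = trans (reflexive (P.cong intR (P.sym (ℤP.◃-inverse z)))) (intR-◃ (sign z) ∣ z ∣)

  intR-* : ∀ x y → intR (x ℤ.* y) ≈ intR x * intR y
  intR-* x y = begin
    intR (sign x Sign.* sign y ◃ ∣ x ∣ ℕ.* ∣ y ∣)                 ≈⟨ intR-◃ (sign x Sign.* sign y) (∣ x ∣ ℕ.* ∣ y ∣) ⟩
    signR (sign x Sign.* sign y) * natR (∣ x ∣ ℕ.* ∣ y ∣)          ≈⟨ *-cong (signR-* (sign x) (sign y)) (natR-* ∣ x ∣ ∣ y ∣) ⟩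
    (signR (sign x) * signR (sign y)) * (natR ∣ x ∣ * natR ∣ y ∣)  ≈⟨ interchange _ _ _ _ ⟩
    (signR (sign x) * natR ∣ x ∣) * (signR (sign y) * natR ∣ y ∣)  ≈⟨ sym (*-cong (intR-signAbs x) (intR-signAbs y)) ⟩
    intR x * intR y                                                ∎
    where
    interchange : ∀ a b c d → (a * b) * (c * d) ≈ (a * c) * (b * d)
    interchange a b c d = begin
      (a * b) * (c * d)  ≈⟨ *-assoc _ _ _ ⟩
      a * (b * (c * d))  ≈⟨ *-congˡ (trans (sym (*-assoc _ _ _)) (trans (*-congʳ (*-comm _ _)) (*-assoc _ _ _))) ⟩
      a * (c * (b * d))  ≈⟨ sym (*-assoc _ _ _) ⟩
      (a * c) * (b * d)  ∎

  ℤ-rawRing : RawRing _ _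
  ℤ-rawRing = CommutativeRing.rawRing ℤP.+-*-commutativeRing

  intR-homomorphism : ℤ-rawRing ACR.-Raw-AlmostCommutative⟶ ACR.fromCommutativeRing CR
  intR-homomorphism = record
    { ⟦_⟧ = intR ; +-homo = intR-+ ; *-homo = intR-* ; -‿homo = intR-neg
    ; 0-homo = refl ; 1-homo = refl }

  intR-dec : ∀ x y → Maybe (intR x ≈ intR y)
  intR-dec x y with x ℤP.≟ y
  ... | yes P.refl = just refl
  ... | no _ = nothing

  open import Algebra.Solver.Ring ℤ-rawRing (ACR.fromCommutativeRing CR) intR-homomorphism intR-dec public

-- Proving L ≈ R from hypotheses Uᵢ ≈ Vᵢ by exhibiting a ring identity
-- L ≈ R + Σ qᵢ (Uᵢ - Vᵢ) (an ideal-membership certificate, checked by the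
-- solver at each use).
module Certificates {c ℓ} (CR : CommutativeRing c ℓ) where
  open CommutativeRing CR
  open import Algebra.Properties.Group +-group using (x≈y⇒x∙y⁻¹≈ε)

  private
    vanish : ∀ q {u v} → u ≈ v → q * (u - v) ≈ 0#
    vanish q e = trans (*-congˡ (x≈y⇒x∙y⁻¹≈ε e)) (zeroʳ q)

    sum-vanish : ∀ {z w} → z ≈ 0# → w ≈ 0# → z + w ≈ 0#
    sum-vanish e e' = trans (+-cong e e') (+-identityʳ _)

    drop : ∀ {L Rt Z} → L ≈ Rt + Z → Z ≈ 0# → L ≈ Rt
    drop e z = trans e (trans (+-congˡ z) (+-identityʳ _))

  certificate₁ : ∀ {L Rt U₁ V₁} q₁ → L ≈ Rt + q₁ * (U₁ - V₁) → U₁ ≈ V₁ → L ≈ Rt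
  certificate₁ q₁ e h₁ = drop e (vanish q₁ h₁)

  certificate₂ : ∀ {L Rt U₁ V₁ U₂ V₂} q₁ q₂ → L ≈ Rt + (q₁ * (U₁ - V₁) + q₂ * (U₂ - V₂)) →
                 U₁ ≈ V₁ → U₂ ≈ V₂ → L ≈ Rt
  certificate₂ q₁ q₂ e h₁ h₂ = drop e (sum-vanish (vanish q₁ h₁) (vanish q₂ h₂))

  certificate₃ : ∀ {L Rt U₁ V₁ U₂ V₂ U₃ V₃} q₁ q₂ q₃ →
                 L ≈ Rt + (q₁ * (U₁ - V₁) + (q₂ * (U₂ - V₂) + q₃ * (U₃ - V₃))) →
                 U₁ ≈ V₁ → U₂ ≈ V₂ → U₃ ≈ V₃ → L ≈ Rt
  certificate₃ q₁ q₂ q₃ e h₁ h₂ h₃ =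
    drop e (sum-vanish (vanish q₁ h₁) (sum-vanish (vanish q₂ h₂) (vanish q₃ h₃)))

  certificate₄ : ∀ {L Rt U₁ V₁ U₂ V₂ U₃ V₃ U₄ V₄} q₁ q₂ q₃ q₄ →
                 L ≈ Rt + (q₁ * (U₁ - V₁) + (q₂ * (U₂ - V₂) + (q₃ * (U₃ - V₃) + q₄ * (U₄ - V₄)))) →
                 U₁ ≈ V₁ → U₂ ≈ V₂ → U₃ ≈ V₃ → U₄ ≈ V₄ → L ≈ Rt
  certificate₄ q₁ q₂ q₃ q₄ e h₁ h₂ h₃ h₄ =
    drop e (sum-vanish (vanish q₁ h₁) (sum-vanish (vanish q₂ h₂) (sum-vanish (vanish q₃ h₃) (vanish q₄ h₄))))

  certificate₅ : ∀ {L Rt U₁ V₁ U₂ V₂ U₃ V₃ U₄ V₄ U₅ V₅} q₁ q₂ q₃ q₄ q₅ →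
                 L ≈ Rt + (q₁ * (U₁ - V₁) + (q₂ * (U₂ - V₂) + (q₃ * (U₃ - V₃) + (q₄ * (U₄ - V₄) + q₅ * (U₅ - V₅))))) →
                 U₁ ≈ V₁ → U₂ ≈ V₂ → U₃ ≈ V₃ → U₄ ≈ V₄ → U₅ ≈ V₅ → L ≈ Rt
  certificate₅ q₁ q₂ q₃ q₄ q₅ e h₁ h₂ h₃ h₄ h₅ =
    drop e (sum-vanish (vanish q₁ h₁) (sum-vanish (vanish q₂ h₂)
           (sum-vanish (vanish q₃ h₃) (sum-vanish (vanish q₄ h₄) (vanish q₅ h₅)))))

module FiniteSums {c ℓ} (R : CommutativeRing c ℓ) where
  open CommutativeRing R hiding (zero)
  open PowerSeries R using (Σ<)
  open import Relation.Binary.Reasoning.Setoid setoid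

  Σ-cong : ∀ n {h h' : ℕ → Carrier} → (∀ i → h i ≈ h' i) → Σ< n h ≈ Σ< n h'
  Σ-cong zero e = refl
  Σ-cong (suc n) e = +-cong (Σ-cong n e) (e n)

  Σ-cong< : ∀ n {h h' : ℕ → Carrier} → (∀ i → i < n → h i ≈ h' i) → Σ< n h ≈ Σ< n h'
  Σ-cong< zero e = refl
  Σ-cong< (suc n) e = +-cong (Σ-cong< n (λ i i<n → e i (ℕP.m<n⇒m<1+n i<n))) (e n ℕP.≤-refl)

  Σ-zero : ∀ n {h : ℕ → Carrier} → (∀ i → i < n → h i ≈ 0#) → Σ< n h ≈ 0#
  Σ-zero zero e = refl
  Σ-zero (suc n) e = trans (+-cong (Σ-zero n (λ i i<n → e i (ℕP.m<n⇒m<1+n i<n))) (e n ℕP.≤-refl)) (+-identityˡ _)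

  Σ-+ : ∀ n (h h' : ℕ → Carrier) → Σ< n (λ i → h i + h' i) ≈ Σ< n h + Σ< n h'
  Σ-+ zero h h' = sym (+-identityˡ _)
  Σ-+ (suc n) h h' = begin
    Σ< n (λ i → h i + h' i) + (h n + h' n)   ≈⟨ +-congʳ (Σ-+ n h h') ⟩
    (Σ< n h + Σ< n h') + (h n + h' n)        ≈⟨ +-assoc _ _ _ ⟩
    Σ< n h + (Σ< n h' + (h n + h' n))        ≈⟨ +-congˡ (trans (sym (+-assoc _ _ _)) (trans (+-congʳ (+-comm _ _)) (+-assoc _ _ _))) ⟩
    Σ< n h + (h n + (Σ< n h' + h' n))        ≈⟨ sym (+-assoc _ _ _) ⟩
    (Σ< n h + h n) + (Σ< n h' + h' n)        ∎

  Σ-*ˡ : ∀ n a (h : ℕ → Carrier) → a * Σ< n h ≈ Σ< n (λ i → a * h i)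
  Σ-*ˡ zero a h = zeroʳ _
  Σ-*ˡ (suc n) a h = trans (distribˡ _ _ _) (+-congʳ (Σ-*ˡ n a h))

  Σ-neg : ∀ n (h : ℕ → Carrier) → - Σ< n h ≈ Σ< n (λ i → - h i)
  Σ-neg zero h = ε⁻¹≈ε
    where open import Algebra.Properties.AbelianGroup +-abelianGroup using (ε⁻¹≈ε)
  Σ-neg (suc n) h = trans (sym (⁻¹-∙-comm _ _)) (+-congʳ (Σ-neg n h))
    where open import Algebra.Properties.AbelianGroup +-abelianGroup using (⁻¹-∙-comm)

  Σ-first : ∀ n (h : ℕ → Carrier) → Σ< (suc n) h ≈ h 0 + Σ< n (λ i → h (suc i))
  Σ-first zero h = +-comm _ _
  Σ-first (suc n) h = trans (+-congʳ (Σ-first n h)) (+-assoc _ _ _)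

  Σ-reverse : ∀ n (h : ℕ → Carrier) → Σ< n h ≈ Σ< n (λ i → h (n ∸ suc i))
  Σ-reverse zero h = refl
  Σ-reverse (suc n) h = begin
    Σ< n h + h n                          ≈⟨ +-comm _ _ ⟩
    h n + Σ< n h                          ≈⟨ +-congˡ (Σ-reverse n h) ⟩
    h n + Σ< n (λ i → h (n ∸ suc i))      ≈⟨ sym (Σ-first n (λ i → h (n ∸ i))) ⟩
    Σ< (suc n) (λ i → h (n ∸ i))          ∎

  Σ-swap : ∀ n m (h : ℕ → ℕ → Carrier) →
           Σ< n (λ i → Σ< m (λ j → h i j)) ≈ Σ< m (λ j → Σ< n (λ i → h i j))
  Σ-swap zero m h = sym (Σ-zero m (λ _ _ → refl))
  Σ-swap (suc n) m h = trans (+-congʳ (Σ-swap n m h)) (sym (Σ-+ m _ _))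

  Σ-extend : ∀ n N (h : ℕ → Carrier) → n ≤ N → (∀ i → n ≤ i → h i ≈ 0#) → Σ< N h ≈ Σ< n h
  Σ-extend n N h n≤N e =
    trans (reflexive (P.cong (λ t → Σ< t h) (P.sym (ℕP.m∸n+n≡m n≤N)))) (go (N ∸ n))
    where
    go : ∀ k → Σ< (k ℕ.+ n) h ≈ Σ< n h
    go zero = refl
    go (suc k) = trans (+-cong (go k) (e _ (ℕP.m≤n+m n k))) (+-identityʳ _)

module SeriesRing {c ℓ} (R : CommutativeRing c ℓ) where
  open CommutativeRing R hiding (zero)
  open PowerSeries R
  open FiniteSums R
  open import Relation.Binary.Reasoning.Setoid setoid

  infixl 6 _+ₛ_
  _+ₛ_ : Series → Series → Series
  (f +ₛ g) n = f n + g n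

  -ₛ_ : Series → Series
  (-ₛ f) n = - f n

  0ₛ : Series
  0ₛ n = 0#

  C : Carrier → Series
  C a zero = a
  C a (suc n) = 0#

  ↑ : Series → Series
  ↑ f n = f (suc n)

  ≈ₛ-refl : ∀ {f} → f ≈ₛ f
  ≈ₛ-refl n = refl

  *ₛ-cong : ∀ {f f' g g'} → f ≈ₛ f' → g ≈ₛ g' → (f *ₛ g) ≈ₛ (f' *ₛ g')
  *ₛ-cong e e' n = Σ-cong (suc n) (λ i → *-cong (e i) (e' (n ∸ i)))

  mul0 : ∀ f g → (f *ₛ g) 0 ≈ f 0 * g 0
  mul0 f g = +-identityˡ _

  mulS : ∀ f g n → (f *ₛ g) (suc n) ≈ f 0 * g (suc n) + (↑ f *ₛ g) n
  mulS f g n = Σ-first (suc n) (λ i → f i * g (suc n ∸ i))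

  constMul : ∀ u f → (∀ i → u (suc i) ≈ 0#) → ∀ n → (u *ₛ f) n ≈ u 0 * f n
  constMul u f e n = begin
    Σ< (suc n) (λ i → u i * f (n ∸ i))                        ≈⟨ Σ-first n _ ⟩
    u 0 * f n + Σ< n (λ i → u (suc i) * f (n ∸ suc i))        ≈⟨ +-congˡ (Σ-zero n (λ i _ → trans (*-congʳ (e i)) (zeroˡ _))) ⟩
    u 0 * f n + 0#                                            ≈⟨ +-identityʳ _ ⟩
    u 0 * f n                                                 ∎

  CMul : ∀ a f n → (C a *ₛ f) n ≈ a * f n
  CMul a f = constMul (C a) f (λ i → refl)

  C-cong : ∀ {a b} → a ≈ b → C a ≈ₛ C b
  C-cong e zero = e
  C-cong e (suc n) = refl

  C-* : ∀ a b → C (a * b) ≈ₛ (C a *ₛ C b)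
  C-* a b zero = sym (CMul a (C b) 0)
  C-* a b (suc n) = sym (trans (CMul a (C b) (suc n)) (zeroʳ _))

  distribʳₛ : ∀ f g h n → ((f +ₛ g) *ₛ h) n ≈ (f *ₛ h) n + (g *ₛ h) n
  distribʳₛ f g h n = trans (Σ-cong (suc n) (λ i → distribʳ _ _ _)) (Σ-+ (suc n) _ _)

  commₛ : ∀ f g n → (f *ₛ g) n ≈ (g *ₛ f) n
  commₛ f g n = begin
    Σ< (suc n) (λ i → f i * g (n ∸ i))                    ≈⟨ Σ-reverse (suc n) _ ⟩
    Σ< (suc n) (λ i → f (n ∸ i) * g (n ∸ (n ∸ i)))        ≈⟨ Σ-cong< (suc n) reindex ⟩
    Σ< (suc n) (λ i → g i * f (n ∸ i))                    ∎
    where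
    reindex : ∀ i → i < suc n → f (n ∸ i) * g (n ∸ (n ∸ i)) ≈ g i * f (n ∸ i)
    reindex i i<n = trans (*-comm _ _) (*-congʳ (reflexive (P.cong g (ℕP.m∸[m∸n]≡n (ℕP.≤-pred i<n)))))

  -- associativity, by induction on the coefficient using the tail formula
  -- ↑ (f g) = f 0 · ↑ g + ↑ f · g
  assocₛ : ∀ n f g h → ((f *ₛ g) *ₛ h) n ≈ (f *ₛ (g *ₛ h)) n
  assocₛ zero f g h = begin
    ((f *ₛ g) *ₛ h) 0   ≈⟨ trans (mul0 (f *ₛ g) h) (*-congʳ (mul0 f g)) ⟩
    (f 0 * g 0) * h 0   ≈⟨ *-assoc _ _ _ ⟩
    f 0 * (g 0 * h 0)   ≈⟨ sym (trans (mul0 f (g *ₛ h)) (*-congˡ (mul0 g h))) ⟩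
    (f *ₛ (g *ₛ h)) 0   ∎
  assocₛ (suc n) f g h = begin
    ((f *ₛ g) *ₛ h) (suc n)                                               ≈⟨ mulS (f *ₛ g) h n ⟩
    (f *ₛ g) 0 * h (suc n) + (↑ (f *ₛ g) *ₛ h) n                          ≈⟨ +-cong (*-congʳ (mul0 f g)) (*ₛ-cong {↑ (f *ₛ g)} {F₀↑g +ₛ (↑ f *ₛ g)} {h} {h} tail ≈ₛ-refl n) ⟩
    (f 0 * g 0) * h (suc n) + ((F₀↑g +ₛ (↑ f *ₛ g)) *ₛ h) n               ≈⟨ +-congˡ (distribʳₛ F₀↑g (↑ f *ₛ g) h n) ⟩
    (f 0 * g 0) * h (suc n) + ((F₀↑g *ₛ h) n + ((↑ f *ₛ g) *ₛ h) n)       ≈⟨ +-congˡ (+-cong scalar (assocₛ n (↑ f) g h)) ⟩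
    (f 0 * g 0) * h (suc n) + (f 0 * (↑ g *ₛ h) n + (↑ f *ₛ (g *ₛ h)) n)  ≈⟨ regroup (f 0) (g 0) (h (suc n)) ((↑ g *ₛ h) n) ((↑ f *ₛ (g *ₛ h)) n) ⟩
    f 0 * (g 0 * h (suc n) + (↑ g *ₛ h) n) + (↑ f *ₛ (g *ₛ h)) n          ≈⟨ +-congʳ (*-congˡ (sym (mulS g h n))) ⟩
    f 0 * (g *ₛ h) (suc n) + (↑ f *ₛ (g *ₛ h)) n                          ≈⟨ sym (mulS f (g *ₛ h) n) ⟩
    (f *ₛ (g *ₛ h)) (suc n)                                               ∎
    where
    F₀↑g : Series
    F₀↑g = C (f 0) *ₛ ↑ g
    tail : ↑ (f *ₛ g) ≈ₛ (F₀↑g +ₛ (↑ f *ₛ g))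
    tail m = trans (mulS f g m) (+-congʳ (sym (CMul (f 0) (↑ g) m)))
    scalar : (F₀↑g *ₛ h) n ≈ f 0 * (↑ g *ₛ h) n
    scalar = begin
      Σ< (suc n) (λ i → F₀↑g i * h (n ∸ i))      ≈⟨ Σ-cong (suc n) (λ i → trans (*-congʳ (CMul (f 0) (↑ g) i)) (*-assoc _ _ _)) ⟩
      Σ< (suc n) (λ i → f 0 * (↑ g i * h (n ∸ i))) ≈⟨ sym (Σ-*ˡ (suc n) (f 0) _) ⟩
      f 0 * (↑ g *ₛ h) n                           ∎
    open IntegerSolver R
    regroup : ∀ a b c d e → (a * b) * c + (a * d + e) ≈ a * (b * c + d) + e
    regroup = solve 5 (λ a b c d e → (a :* b) :* c :+ (a :* d :+ e) := a :* (b :* c :+ d) :+ e) refl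

  oneMul : ∀ f n → (one *ₛ f) n ≈ f n
  oneMul f n = trans (constMul one f (λ i → refl) n) (*-identityˡ _)

  SR : CommutativeRing c ℓ
  SR = record
    { Carrier = Series ; _≈_ = _≈ₛ_ ; _+_ = _+ₛ_ ; _*_ = _*ₛ_ ; -_ = -ₛ_ ; 0# = 0ₛ ; 1# = one
    ; isCommutativeRing = record
      { isRing = record
        { +-isAbelianGroup = record
          { isGroup = record
            { isMonoid = record
              { isSemigroup = record
                { isMagma = record
                  { isEquivalence = record
                    { refl = ≈ₛ-refl ; sym = λ e n → sym (e n) ; trans = λ e e' n → trans (e n) (e' n) }
                  ; ∙-cong = λ e e' n → +-cong (e n) (e' n) }
                ; assoc = λ f g h n → +-assoc _ _ _ }
              ; identity = (λ f n → +-identityˡ _) , (λ f n → +-identityʳ _) }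
            ; inverse = (λ f n → -‿inverseˡ _) , (λ f n → -‿inverseʳ _)
            ; ⁻¹-cong = λ e n → -‿cong (e n) }
          ; comm = λ f g n → +-comm _ _ }
        ; *-cong = *ₛ-cong
        ; *-assoc = λ f g h n → assocₛ n f g h
        ; *-identity = (λ f n → oneMul f n) , (λ f n → trans (commₛ f one n) (oneMul f n))
        ; distrib = (λ f g h n → trans (commₛ f (g +ₛ h) n) (trans (distribʳₛ g h f n) (+-cong (commₛ g f n) (commₛ h f n))))
                  , (λ f g h n → distribʳₛ g h f n) }
      ; *-comm = λ f g n → commₛ f g n } }

  module S = CommutativeRing SR

  Xmul0 : ∀ u → (X *ₛ u) 0 ≈ 0#
  Xmul0 u = trans (mul0 X u) (zeroˡ _)

  XmulS : ∀ u n → (X *ₛ u) (suc n) ≈ u n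
  XmulS u n = begin
    (X *ₛ u) (suc n)                 ≈⟨ mulS X u n ⟩
    X 0 * u (suc n) + (↑ X *ₛ u) n   ≈⟨ +-cong (zeroˡ _) (constMul (↑ X) u (λ i → refl) n) ⟩
    0# + 1# * u n                    ≈⟨ trans (+-identityˡ _) (*-identityˡ _) ⟩
    u n                              ∎

module Derivative {c ℓ} (R : CommutativeRing c ℓ) where
  open CommutativeRing R hiding (zero)
  open PowerSeries R
  open FiniteSums R
  open SeriesRing R
  open import Relation.Binary.Reasoning.Setoid setoid

  fromℕ-+ : ∀ m n → fromℕ (m ℕ.+ n) ≈ fromℕ m + fromℕ n
  fromℕ-+ zero n = sym (+-identityˡ _)
  fromℕ-+ (suc m) n = trans (+-congˡ (fromℕ-+ m n)) (sym (+-assoc _ _ _))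

  D-cong : ∀ {f g} → f ≈ₛ g → deriv f ≈ₛ deriv g
  D-cong e n = *-congˡ (e (suc n))

  D-+ : ∀ f g → deriv (f +ₛ g) ≈ₛ (deriv f +ₛ deriv g)
  D-+ f g n = distribˡ _ _ _

  D-neg : ∀ f → deriv (-ₛ f) ≈ₛ (-ₛ deriv f)
  D-neg f n = sym (-‿distribʳ-* _ _)
    where open import Algebra.Properties.Ring ring using (-‿distribʳ-*)

  D-C : ∀ a → deriv (C a) ≈ₛ 0ₛ
  D-C a n = zeroʳ _

  D-one : deriv one ≈ₛ 0ₛ
  D-one n = zeroʳ _

  D-X : deriv X ≈ₛ one
  D-X zero = trans (*-congʳ (+-identityʳ _)) (*-identityˡ _)
  D-X (suc n) = zeroʳ _

  -- (f g)' = f' g + f g': split (n+1) = i + (n+1-i) in each summand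
  leibniz : ∀ f g → deriv (f *ₛ g) ≈ₛ ((deriv f *ₛ g) +ₛ (f *ₛ deriv g))
  leibniz f g n = begin
    fromℕ (suc n) * Σ< (suc (suc n)) (λ i → f i * g (suc n ∸ i))     ≈⟨ Σ-*ˡ (suc (suc n)) _ _ ⟩
    Σ< (suc (suc n)) (λ i → fromℕ (suc n) * (f i * g (suc n ∸ i)))   ≈⟨ Σ-cong< (suc (suc n)) split ⟩
    Σ< (suc (suc n)) (λ i → A i + B i)                               ≈⟨ Σ-+ (suc (suc n)) A B ⟩
    Σ< (suc (suc n)) A + Σ< (suc (suc n)) B                          ≈⟨ +-cong sumA sumB ⟩
    (deriv f *ₛ g) n + (f *ₛ deriv g) n                              ∎
    where
    A B : ℕ → Carrier
    A i = fromℕ i * (f i * g (suc n ∸ i))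
    B i = fromℕ (suc n ∸ i) * (f i * g (suc n ∸ i))
    split : ∀ i → i < suc (suc n) → fromℕ (suc n) * (f i * g (suc n ∸ i)) ≈ A i + B i
    split i i<2 = trans (*-congʳ (trans (reflexive (P.cong fromℕ (P.sym (ℕP.m+[n∸m]≡n (ℕP.≤-pred i<2)))))
                                         (fromℕ-+ i (suc n ∸ i))))
                        (distribʳ _ _ _)
    sumA : Σ< (suc (suc n)) A ≈ (deriv f *ₛ g) n
    sumA = begin
      Σ< (suc (suc n)) A                  ≈⟨ Σ-first (suc n) A ⟩
      A 0 + Σ< (suc n) (λ i → A (suc i))  ≈⟨ +-cong (zeroˡ _) (Σ-cong (suc n) (λ i → sym (*-assoc _ _ _))) ⟩
      0# + (deriv f *ₛ g) n               ≈⟨ +-identityˡ _ ⟩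
      (deriv f *ₛ g) n                    ∎
    sumB : Σ< (suc (suc n)) B ≈ (f *ₛ deriv g) n
    sumB = begin
      Σ< (suc n) B + B (suc n)  ≈⟨ +-congˡ (trans (*-congʳ (reflexive (P.cong fromℕ (ℕP.n∸n≡0 n)))) (zeroˡ _)) ⟩
      Σ< (suc n) B + 0#         ≈⟨ +-identityʳ _ ⟩
      Σ< (suc n) B              ≈⟨ Σ-cong< (suc n) term ⟩
      (f *ₛ deriv g) n          ∎
      where
      term : ∀ i → i < suc n → B i ≈ f i * deriv g (n ∸ i)
      term i i<n rewrite ℕP.+-∸-assoc 1 (ℕP.≤-pred i<n) =
        trans (sym (*-assoc _ _ _)) (trans (*-congʳ (*-comm _ _)) (*-assoc _ _ _))

  D-shift : ∀ f → deriv f ≈ₛ (↑ f +ₛ (X *ₛ deriv (↑ f)))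
  D-shift f zero = trans (trans (*-congʳ (+-identityʳ _)) (*-identityˡ _))
                         (sym (trans (+-congˡ (Xmul0 (deriv (↑ f)))) (+-identityʳ _)))
  D-shift f (suc n) = trans (trans (distribʳ _ _ _) (+-congʳ (*-identityˡ _)))
                            (sym (+-congˡ (XmulS (deriv (↑ f)) n)))

  D-injective : (inv : ℕ → Carrier) → IsNatInverse R inv →
                ∀ f g → f 0 ≈ g 0 → deriv f ≈ₛ deriv g → f ≈ₛ g
  D-injective inv invP f g e0 eD zero = e0
  D-injective inv invP f g e0 eD (suc n) = begin
    f (suc n)                              ≈⟨ sym (*-identityˡ _) ⟩
    1# * f (suc n)                         ≈⟨ *-congʳ (sym inv·n+1) ⟩
    (inv n * fromℕ (suc n)) * f (suc n)    ≈⟨ *-assoc _ _ _ ⟩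
    inv n * deriv f n                      ≈⟨ *-congˡ (eD n) ⟩
    inv n * deriv g n                      ≈⟨ sym (*-assoc _ _ _) ⟩
    (inv n * fromℕ (suc n)) * g (suc n)    ≈⟨ *-congʳ inv·n+1 ⟩
    1# * g (suc n)                         ≈⟨ *-identityˡ _ ⟩
    g (suc n)                              ∎
    where
    inv·n+1 : inv n * fromℕ (suc n) ≈ 1#
    inv·n+1 = trans (*-comm _ _) (invP n)

module Units {c ℓ} (R : CommutativeRing c ℓ) where
  open CommutativeRing R hiding (zero)
  open PowerSeries R
  open FiniteSums R
  open SeriesRing R
  open import Relation.Binary.Reasoning.Setoid setoid
  open import Data.List using (map; zipWith; foldr; upTo; applyUpTo)
  import Data.List.Properties as LP
  open import Data.Nat.Induction using (<-rec)

  unit-cancel : ∀ v w e → v 0 * e ≈ 1# → (v *ₛ w) ≈ₛ 0ₛ → w ≈ₛ 0ₛ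
  unit-cancel v w e ve vw = <-rec (λ m → w m ≈ 0#) step
    where
    step : ∀ m → (∀ {i} → i < m → w i ≈ 0#) → w m ≈ 0#
    step m ih = begin
      w m                 ≈⟨ sym (*-identityʳ _) ⟩
      w m * 1#            ≈⟨ *-congˡ (sym ve) ⟩
      w m * (v 0 * e)     ≈⟨ sym (*-assoc _ _ _) ⟩
      (w m * v 0) * e     ≈⟨ *-congʳ leading ⟩
      0# * e              ≈⟨ zeroˡ _ ⟩
      0#                  ∎
      where
      -- the coefficient m of w v reduces to w m · v 0 by the hypothesis
      leading : w m * v 0 ≈ 0#
      leading = begin
        w m * v 0                                      ≈⟨ sym (+-identityˡ _) ⟩
        0# + w m * v 0                                 ≈⟨ +-congʳ (sym (Σ-zero m (λ i i<m → trans (*-congʳ (ih i<m)) (zeroˡ _)))) ⟩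
        Σ< m (λ i → w i * v (m ∸ i)) + w m * v 0       ≈⟨ +-congˡ (*-congˡ (reflexive (P.cong v (P.sym (ℕP.n∸n≡0 m))))) ⟩
        (w *ₛ v) m                                     ≈⟨ commₛ w v m ⟩
        (v *ₛ w) m                                     ≈⟨ vw m ⟩
        0#                                             ∎

  recip-fold : ∀ a (h : ℕ → Carrier) n →
    foldr _+_ 0# (zipWith _*_ (applyUpTo h (suc n)) (recip-list a n)) ≈ Σ< (suc n) (λ i → h i * recip a (n ∸ i))
  recip-fold a h zero = trans (+-identityʳ _) (sym (+-identityˡ _))
  recip-fold a h (suc n) = begin
    h 0 * recip a (suc n) + foldr _+_ 0# (zipWith _*_ (applyUpTo (h ∘ suc) (suc n)) (recip-list a n))
      ≈⟨ +-congˡ (recip-fold a (h ∘ suc) n) ⟩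
    h 0 * recip a (suc n) + Σ< (suc n) (λ i → h (suc i) * recip a (n ∸ i))
      ≈⟨ sym (Σ-first (suc n) (λ i → h i * recip a (suc n ∸ i))) ⟩
    Σ< (suc (suc n)) (λ i → h i * recip a (suc n ∸ i)) ∎

  -- by definition recip g (n+1) = - Σ_{i ≤ n} g (i+1) · recip g (n-i)
  recip-inverse : ∀ g → g 0 ≈ 1# → (g *ₛ recip g) ≈ₛ one
  recip-inverse g g0 zero = trans (mul0 g (recip g)) (trans (*-identityʳ _) g0)
  recip-inverse g g0 (suc n) = begin
    (g *ₛ recip g) (suc n)                      ≈⟨ mulS g (recip g) n ⟩
    g 0 * recip g (suc n) + (↑ g *ₛ recip g) n  ≈⟨ +-congʳ (trans (*-congʳ g0) (*-identityˡ _)) ⟩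
    - tail + (↑ g *ₛ recip g) n                 ≈⟨ +-congˡ (sym tail≈) ⟩
    - tail + tail                               ≈⟨ -‿inverseˡ _ ⟩
    0#                                          ∎
    where
    tail : Carrier
    tail = foldr _+_ 0# (zipWith _*_ (map (g ∘ suc) (upTo (suc n))) (recip-list g n))
    tail≈ : tail ≈ (↑ g *ₛ recip g) n
    tail≈ = trans (reflexive (P.cong (λ L → foldr _+_ 0# (zipWith _*_ L (recip-list g n))) (LP.map-upTo (g ∘ suc) (suc n))))
                  (recip-fold g (g ∘ suc) n)

module Composition {c ℓ} (R : CommutativeRing c ℓ) where
  open CommutativeRing R hiding (zero)
  open PowerSeries R
  open FiniteSums R
  open SeriesRing R
  open Derivative R
  open import Relation.Binary.Reasoning.Setoid setoid
  open import Data.Nat.Induction using (<-rec)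

  ∸-suc-< : ∀ n i → suc i ≤ n → n ∸ suc i < n
  ∸-suc-< n i le = ℕP.∸-monoʳ-< {n} {suc i} {0} (s≤s z≤n) le

  powₛ-cong : ∀ {g g'} → g ≈ₛ g' → ∀ j → powₛ g j ≈ₛ powₛ g' j
  powₛ-cong e zero = ≈ₛ-refl
  powₛ-cong e (suc j) = *ₛ-cong e (powₛ-cong e j)

  compose-cong : ∀ {f f' g g'} → f ≈ₛ f' → g ≈ₛ g' → compose f g ≈ₛ compose f' g'
  compose-cong e e' n = Σ-cong (suc n) (λ j → *-cong (e j) (powₛ-cong e' j n))

  compose-+ : ∀ f h g → compose (f +ₛ h) g ≈ₛ (compose f g +ₛ compose h g)
  compose-+ f h g n = trans (Σ-cong (suc n) (λ j → distribʳ _ _ _)) (Σ-+ (suc n) _ _)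

  compose-neg : ∀ f g → compose (-ₛ f) g ≈ₛ (-ₛ compose f g)
  compose-neg f g n = trans (Σ-cong (suc n) (λ j → sym (-‿distribˡ-* _ _))) (sym (Σ-neg (suc n) _))
    where open import Algebra.Properties.Ring ring using (-‿distribˡ-*)

  compose-Cmul : ∀ a f g → compose (C a *ₛ f) g ≈ₛ (C a *ₛ compose f g)
  compose-Cmul a f g n = begin
    Σ< (suc n) (λ j → (C a *ₛ f) j * powₛ g j n)   ≈⟨ Σ-cong (suc n) (λ j → trans (*-congʳ (CMul a f j)) (*-assoc _ _ _)) ⟩
    Σ< (suc n) (λ j → a * (f j * powₛ g j n))      ≈⟨ sym (Σ-*ˡ (suc n) a _) ⟩
    a * compose f g n                              ≈⟨ sym (CMul a (compose f g) n) ⟩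
    (C a *ₛ compose f g) n                         ∎

  compose0 : ∀ f g → compose f g 0 ≈ f 0
  compose0 f g = trans (+-identityˡ _) (*-identityʳ _)

  module Substitution (g : Series) (g0 : g 0 ≈ 0#) where

    pow-order : ∀ j n → n < j → powₛ g j n ≈ 0#
    pow-order (suc j) n n<j = Σ-zero (suc n) term
      where
      term : ∀ i → i < suc n → g i * powₛ g j (n ∸ i) ≈ 0#
      term zero _ = trans (*-congʳ g0) (zeroˡ _)
      term (suc i) i<n =
        trans (*-congˡ (pow-order j (n ∸ suc i) (ℕP.<-≤-trans (∸-suc-< n i (ℕP.≤-pred i<n)) (ℕP.≤-pred n<j)))) (zeroʳ _)

    compose-extend : ∀ f n N → suc n ≤ N → compose f g n ≈ Σ< N (λ j → f j * powₛ g j n)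
    compose-extend f n N le = sym (Σ-extend (suc n) N _ le (λ i i≥ → trans (*-congˡ (pow-order i n i≥)) (zeroʳ _)))

    mul-local : ∀ u v n → (∀ m → m < n → u m ≈ v m) → (g *ₛ u) n ≈ (g *ₛ v) n
    mul-local u v n e = Σ-cong< (suc n) term
      where
      term : ∀ i → i < suc n → g i * u (n ∸ i) ≈ g i * v (n ∸ i)
      term zero _ = trans (*-congʳ g0) (trans (zeroˡ _) (sym (trans (*-congʳ g0) (zeroˡ _))))
      term (suc i) i<n = *-congˡ (e _ (∸-suc-< n i (ℕP.≤-pred i<n)))

    horner : ∀ f → compose f g ≈ₛ (C (f 0) +ₛ (g *ₛ compose (↑ f) g))
    horner f n = begin
      Σ< (suc n) (λ j → f j * powₛ g j n)                                   ≈⟨ Σ-first n _ ⟩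
      f 0 * one n + Σ< n (λ j → f (suc j) * (g *ₛ powₛ g j) n)              ≈⟨ +-cong (constant n) (sym dropTop) ⟩
      C (f 0) n + Σ< (suc n) (λ j → f (suc j) * (g *ₛ powₛ g j) n)          ≈⟨ +-congˡ (sym inner) ⟩
      C (f 0) n + (g *ₛ compose (↑ f) g) n                                  ∎
      where
      constant : ∀ n → f 0 * one n ≈ C (f 0) n
      constant zero = *-identityʳ _
      constant (suc n) = zeroʳ _
      dropTop : Σ< (suc n) (λ j → f (suc j) * (g *ₛ powₛ g j) n) ≈ Σ< n (λ j → f (suc j) * (g *ₛ powₛ g j) n)
      dropTop = trans (+-congˡ (trans (*-congˡ (pow-order (suc n) n ℕP.≤-refl)) (zeroʳ _))) (+-identityʳ _)
      swap-middle : ∀ a b d → a * (b * d) ≈ b * (a * d)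
      swap-middle a b d = trans (sym (*-assoc _ _ _)) (trans (*-congʳ (*-comm _ _)) (*-assoc _ _ _))
      inner : (g *ₛ compose (↑ f) g) n ≈ Σ< (suc n) (λ j → f (suc j) * (g *ₛ powₛ g j) n)
      inner = begin
        Σ< (suc n) (λ i → g i * compose (↑ f) g (n ∸ i))
          ≈⟨ Σ-cong< (suc n) (λ i i<n → *-congˡ (compose-extend (↑ f) (n ∸ i) (suc n) (s≤s (ℕP.m∸n≤m n i)))) ⟩
        Σ< (suc n) (λ i → g i * Σ< (suc n) (λ j → f (suc j) * powₛ g j (n ∸ i)))
          ≈⟨ Σ-cong (suc n) (λ i → trans (Σ-*ˡ (suc n) _ _) (Σ-cong (suc n) (λ j → swap-middle _ _ _))) ⟩
        Σ< (suc n) (λ i → Σ< (suc n) (λ j → f (suc j) * (g i * powₛ g j (n ∸ i))))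
          ≈⟨ Σ-swap (suc n) (suc n) _ ⟩
        Σ< (suc n) (λ j → Σ< (suc n) (λ i → f (suc j) * (g i * powₛ g j (n ∸ i))))
          ≈⟨ Σ-cong (suc n) (λ j → sym (Σ-*ˡ (suc n) _ _)) ⟩
        Σ< (suc n) (λ j → f (suc j) * (g *ₛ powₛ g j) n) ∎

    compose-const : ∀ u → (∀ i → u (suc i) ≈ 0#) → compose u g ≈ₛ C (u 0)
    compose-const u e n = begin
      compose u g n                          ≈⟨ horner u n ⟩
      C (u 0) n + (g *ₛ compose (↑ u) g) n   ≈⟨ +-congˡ (Σ-zero (suc n) (λ i _ → trans (*-congˡ (Σ-zero (suc (n ∸ i)) (λ j _ → trans (*-congʳ (e j)) (zeroˡ _)))) (zeroʳ _))) ⟩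
      C (u 0) n + 0#                         ≈⟨ +-identityʳ _ ⟩
      C (u 0) n                              ∎

    compose-one : compose one g ≈ₛ one
    compose-one n = trans (compose-const one (λ i → refl) n) (C1≈one n)
      where
      C1≈one : C 1# ≈ₛ one
      C1≈one zero = refl
      C1≈one (suc n) = refl

    compose-X : compose X g ≈ₛ g
    compose-X n = begin
      compose X g n                       ≈⟨ horner X n ⟩
      C 0# n + (g *ₛ compose (↑ X) g) n   ≈⟨ +-cong (C0≈0 n) (*ₛ-cong {g} {g} ≈ₛ-refl (compose-const (↑ X) (λ i → refl)) n) ⟩
      0# + (g *ₛ C 1#) n                  ≈⟨ +-identityˡ _ ⟩
      (g *ₛ C 1#) n                       ≈⟨ commₛ g (C 1#) n ⟩
      (C 1# *ₛ g) n                       ≈⟨ CMul 1# g n ⟩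
      1# * g n                            ≈⟨ *-identityˡ _ ⟩
      g n                                 ∎
      where
      C0≈0 : ∀ n → C 0# n ≈ 0#
      C0≈0 zero = refl
      C0≈0 (suc n) = refl

    -- (f h) ∘ g = (f ∘ g)(h ∘ g), by strong induction on the coefficient:
    -- Horner's rule reduces coefficient n to lower coefficients of ↑ f · h
    compose-* : ∀ f h → compose (f *ₛ h) g ≈ₛ (compose f g *ₛ compose h g)
    compose-* f h n = <-rec (λ n → ∀ f h → compose (f *ₛ h) g n ≈ (compose f g *ₛ compose h g) n) step n f h
      where
      step : ∀ n → (∀ {m} → m < n → ∀ f h → compose (f *ₛ h) g m ≈ (compose f g *ₛ compose h g) m) →
             ∀ f h → compose (f *ₛ h) g n ≈ (compose f g *ₛ compose h g) n
      step n ih f h = begin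
        compose (f *ₛ h) g n
          ≈⟨ horner (f *ₛ h) n ⟩
        (C ((f *ₛ h) 0) +ₛ (g *ₛ compose (↑ (f *ₛ h)) g)) n
          ≈⟨ +-cong (C-cong (mul0 f h) n) (*ₛ-cong {g} {g} ≈ₛ-refl tail n) ⟩
        (C (f 0 * h 0) +ₛ (g *ₛ ((Ca *ₛ Hh) +ₛ compose (↑ f *ₛ h) g))) n
          ≈⟨ +-cong (C-* (f 0) (h 0) n) (mul-local ((Ca *ₛ Hh) +ₛ compose (↑ f *ₛ h) g) ((Ca *ₛ Hh) +ₛ (F *ₛ compose h g)) n (λ m m<n → +-congˡ (ih m<n (↑ f) h))) ⟩
        ((Ca *ₛ Cb) +ₛ (g *ₛ ((Ca *ₛ Hh) +ₛ (F *ₛ compose h g)))) n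
          ≈⟨ S.trans (S.+-congˡ {Ca *ₛ Cb} (S.*-congˡ {g} (S.+-congˡ {Ca *ₛ Hh} (S.*-congˡ {F} (horner h)))))
                     (S.sym (expand Ca Cb g F Hh)) n ⟩
        ((Ca +ₛ (g *ₛ F)) *ₛ (Cb +ₛ (g *ₛ Hh))) n
          ≈⟨ *ₛ-cong {Ca +ₛ (g *ₛ F)} {compose f g} {Cb +ₛ (g *ₛ Hh)} {compose h g} (S.sym (horner f)) (S.sym (horner h)) n ⟩
        (compose f g *ₛ compose h g) n ∎
        where
        Ca Cb F Hh : Series
        Ca = C (f 0)
        Cb = C (h 0)
        F = compose (↑ f) g
        Hh = compose (↑ h) g
        tail : compose (↑ (f *ₛ h)) g ≈ₛ ((Ca *ₛ Hh) +ₛ compose (↑ f *ₛ h) g)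
        tail = S.trans (compose-cong (λ m → trans (mulS f h m) (+-congʳ (sym (CMul (f 0) (↑ h) m)))) ≈ₛ-refl)
                 (S.trans (compose-+ (C (f 0) *ₛ ↑ h) (↑ f *ₛ h) g)
                   (λ m → +-congʳ (compose-Cmul (f 0) (↑ h) g m)))
        expand : ∀ a b x y z → ((a +ₛ (x *ₛ y)) *ₛ (b +ₛ (x *ₛ z))) ≈ₛ ((a *ₛ b) +ₛ (x *ₛ ((a *ₛ z) +ₛ (y *ₛ (b +ₛ (x *ₛ z))))))
        expand = solve 5 (λ a b x y z → (a :+ x :* y) :* (b :+ x :* z) := a :* b :+ x :* (a :* z :+ y :* (b :+ x :* z))) S.refl
          where open IntegerSolver SR

    chain : ∀ f → deriv (compose f g) ≈ₛ (compose (deriv f) g *ₛ deriv g)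
    chain f n = <-rec (λ n → ∀ f → deriv (compose f g) n ≈ (compose (deriv f) g *ₛ deriv g) n) step n f
      where
      step : ∀ n → (∀ {m} → m < n → ∀ f → deriv (compose f g) m ≈ (compose (deriv f) g *ₛ deriv g) m) →
             ∀ f → deriv (compose f g) n ≈ (compose (deriv f) g *ₛ deriv g) n
      step n ih f = begin
        deriv (compose f g) n                       ≈⟨ D-cong (horner f) n ⟩
        deriv (C (f 0) +ₛ (g *ₛ F)) n               ≈⟨ trans (D-+ (C (f 0)) (g *ₛ F) n) (+-cong (D-C (f 0) n) (leibniz g F n)) ⟩
        0# + ((Dg *ₛ F) n + (g *ₛ deriv F) n)       ≈⟨ +-identityˡ _ ⟩
        (Dg *ₛ F) n + (g *ₛ deriv F) n              ≈⟨ +-congˡ (mul-local (deriv F) (G' *ₛ Dg) n (λ m m<n → ih m<n (↑ f))) ⟩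
        (Dg *ₛ F) n + (g *ₛ (G' *ₛ Dg)) n           ≈⟨ collect F G' g Dg n ⟩
        ((F +ₛ (g *ₛ G')) *ₛ Dg) n                  ≈⟨ *ₛ-cong {F +ₛ (g *ₛ G')} {compose (deriv f) g} {Dg} {Dg} (S.sym derivHorner) ≈ₛ-refl n ⟩
        (compose (deriv f) g *ₛ Dg) n               ∎
        where
        F G' Dg : Series
        F = compose (↑ f) g
        G' = compose (deriv (↑ f)) g
        Dg = deriv g
        -- f' ∘ g = (↑ f) ∘ g + g ((↑ f)' ∘ g), from f' = ↑ f + x (↑ f)'
        derivHorner : compose (deriv f) g ≈ₛ (F +ₛ (g *ₛ G'))
        derivHorner = S.trans (compose-cong (D-shift f) ≈ₛ-refl)
                 (S.trans (compose-+ (↑ f) (X *ₛ deriv (↑ f)) g)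
                   (λ m → +-congˡ (trans (compose-* X (deriv (↑ f)) m) (*ₛ-cong {compose X g} {g} {G'} {G'} compose-X ≈ₛ-refl m))))
        collect : ∀ a b x y → ((y *ₛ a) +ₛ (x *ₛ (b *ₛ y))) ≈ₛ ((a +ₛ (x *ₛ b)) *ₛ y)
        collect = solve 4 (λ a b x y → y :* a :+ x :* (b :* y) := (a :+ x :* b) :* y) S.refl
          where open IntegerSolver SR

  -- a series T with T 1 = 1 can be cancelled on the left of ∘: the
  -- coefficient n of T ∘ F is F n plus terms involving only lower
  -- coefficients of F
  compose-cancelˡ : ∀ T F G → T 1 ≈ 1# → F 0 ≈ 0# → G 0 ≈ 0# → compose T F ≈ₛ compose T G → F ≈ₛ G
  compose-cancelˡ T F G T1 F0 G0 eq = <-rec (λ n → F n ≈ G n) step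
    where
    module SF = Substitution F F0
    module SG = Substitution G G0
    step : ∀ n → (∀ {m} → m < n → F m ≈ G m) → F n ≈ G n
    step zero ih = trans F0 (sym G0)
    step (suc n') ih = begin
      F n                ≈⟨ sym (*-identityˡ _) ⟩
      1# * F n           ≈⟨ *-congʳ (sym T1) ⟩
      T 1 * F n          ≈⟨ *-congˡ (sym (S.*-identityʳ F n)) ⟩
      T 1 * powₛ F 1 n   ≈⟨ +-cancelʳ _ _ _ (+-cancelˡ _ _ _ compared) ⟩
      T 1 * powₛ G 1 n   ≈⟨ *-congˡ (S.*-identityʳ G n) ⟩
      T 1 * G n          ≈⟨ *-congʳ T1 ⟩
      1# * G n           ≈⟨ *-identityˡ _ ⟩
      G n                ∎
      where
      n : ℕ
      n = suc n'
      open import Algebra.Properties.Group +-group using () renaming (∙-cancelˡ to +-cancelˡ; ∙-cancelʳ to +-cancelʳ)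
      pow-below : ∀ j m → m < n → powₛ F j m ≈ powₛ G j m
      pow-below zero m m<n = refl
      pow-below (suc j) m m<n = Σ-cong< (suc m) (λ i i<m →
        *-cong (ih (ℕP.≤-<-trans (ℕP.≤-pred i<m) m<n)) (pow-below j (m ∸ i) (ℕP.≤-<-trans (ℕP.m∸n≤m m i) m<n)))
      -- the powers F^j, j ≥ 2, do not involve F n in their coefficient n
      pow-top : ∀ j → powₛ F (suc (suc j)) n ≈ powₛ G (suc (suc j)) n
      pow-top j = Σ-cong< (suc n) term
        where
        term : ∀ i → i < suc n → F i * powₛ F (suc j) (n ∸ i) ≈ G i * powₛ G (suc j) (n ∸ i)
        term zero _ = trans (*-congʳ F0) (trans (zeroˡ _) (sym (trans (*-congʳ G0) (zeroˡ _))))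
        term (suc i) i<n with ℕP.m<1+n⇒m<n∨m≡n i<n
        ... | inj₁ lt = *-cong (ih lt) (pow-below (suc j) (n ∸ suc i) (∸-suc-< n i (ℕP.≤-pred i<n)))
        ... | inj₂ P.refl = trans (*-congˡ (trans (reflexive (P.cong (powₛ F (suc j)) (ℕP.n∸n≡0 n'))) (SF.pow-order (suc j) 0 (s≤s z≤n))))
                                  (trans (zeroʳ _) (sym (trans (*-congˡ (trans (reflexive (P.cong (powₛ G (suc j)) (ℕP.n∸n≡0 n'))) (SG.pow-order (suc j) 0 (s≤s z≤n)))) (zeroʳ _))))
      hF hG : ℕ → Carrier
      hF j = T j * powₛ F j n
      hG j = T j * powₛ G j n
      compared : T 0 * one n + (T 1 * powₛ F 1 n + Σ< n' (λ j → hF (suc (suc j))))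
               ≈ T 0 * one n + (T 1 * powₛ G 1 n + Σ< n' (λ j → hF (suc (suc j))))
      compared = begin
        T 0 * one n + (T 1 * powₛ F 1 n + Σ< n' (λ j → hF (suc (suc j))))  ≈⟨ +-congˡ (sym (Σ-first n' (λ j → hF (suc j)))) ⟩
        T 0 * one n + Σ< n (λ j → hF (suc j))                              ≈⟨ sym (Σ-first n hF) ⟩
        compose T F n                                                      ≈⟨ eq n ⟩
        compose T G n                                                      ≈⟨ Σ-first n hG ⟩
        T 0 * one n + Σ< n (λ j → hG (suc j))                              ≈⟨ +-congˡ (Σ-first n' (λ j → hG (suc j))) ⟩
        T 0 * one n + (T 1 * powₛ G 1 n + Σ< n' (λ j → hG (suc (suc j))))  ≈⟨ +-congˡ (+-congˡ (Σ-cong n' (λ j → *-congˡ (sym (pow-top j))))) ⟩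
        T 0 * one n + (T 1 * powₛ G 1 n + Σ< n' (λ j → hF (suc (suc j))))  ∎

module Dilation {c ℓ} (R : CommutativeRing c ℓ) (λ₀ : CommutativeRing.Carrier R) where
  open CommutativeRing R hiding (zero)
  open PowerSeries R
  open FiniteSums R
  open SeriesRing R
  open import Relation.Binary.Reasoning.Setoid setoid

  dilate : Series → Series
  dilate f n = powR λ₀ n * f n

  powR-+ : ∀ m n → powR λ₀ (m ℕ.+ n) ≈ powR λ₀ m * powR λ₀ n
  powR-+ zero n = sym (*-identityˡ _)
  powR-+ (suc m) n = trans (*-congˡ (powR-+ m n)) (sym (*-assoc _ _ _))

  dilate-cong : ∀ {f g} → f ≈ₛ g → dilate f ≈ₛ dilate g
  dilate-cong e n = *-congˡ (e n)

  dilate-* : ∀ f h → dilate (f *ₛ h) ≈ₛ (dilate f *ₛ dilate h)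
  dilate-* f h n = trans (Σ-*ˡ (suc n) _ _) (Σ-cong< (suc n) term)
    where
    term : ∀ i → i < suc n → powR λ₀ n * (f i * h (n ∸ i)) ≈ (powR λ₀ i * f i) * (powR λ₀ (n ∸ i) * h (n ∸ i))
    term i i<n = begin
      powR λ₀ n * (f i * h (n ∸ i))
        ≈⟨ *-congʳ (trans (reflexive (P.cong (powR λ₀) (P.sym (ℕP.m+[n∸m]≡n (ℕP.≤-pred i<n))))) (powR-+ i (n ∸ i))) ⟩
      (powR λ₀ i * powR λ₀ (n ∸ i)) * (f i * h (n ∸ i))
        ≈⟨ interchange _ _ _ _ ⟩
      (powR λ₀ i * f i) * (powR λ₀ (n ∸ i) * h (n ∸ i)) ∎
      where
      interchange : ∀ a b x y → (a * b) * (x * y) ≈ (a * x) * (b * y)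
      interchange = solve 4 (λ a b x y → (a :* b) :* (x :* y) := (a :* x) :* (b :* y)) refl
        where open IntegerSolver R

  dilate-one : dilate one ≈ₛ one
  dilate-one zero = *-identityˡ _
  dilate-one (suc n) = zeroʳ _

  dilate-pow : ∀ g j → powₛ (dilate g) j ≈ₛ dilate (powₛ g j)
  dilate-pow g zero = S.sym dilate-one
  dilate-pow g (suc j) =
    S.trans (*ₛ-cong {dilate g} {dilate g} {powₛ (dilate g) j} {dilate (powₛ g j)} ≈ₛ-refl (dilate-pow g j))
            (S.sym (dilate-* g (powₛ g j)))

  dilate-compose : ∀ f g → compose f (dilate g) ≈ₛ dilate (compose f g)
  dilate-compose f g n =
    trans (Σ-cong (suc n) (λ j → trans (*-congˡ (dilate-pow g j n)) (trans (sym (*-assoc _ _ _)) (trans (*-congʳ (*-comm _ _)) (*-assoc _ _ _)))))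
          (sym (Σ-*ˡ (suc n) _ _))

  dilate-X : dilate X ≈ₛ (C λ₀ *ₛ X)
  dilate-X n = trans (coefficient n) (sym (CMul λ₀ X n))
    where
    coefficient : ∀ n → dilate X n ≈ λ₀ * X n
    coefficient zero = trans (zeroʳ _) (sym (zeroʳ _))
    coefficient (suc zero) = trans (*-identityʳ _) (trans (*-identityʳ _) (sym (*-identityʳ _)))
    coefficient (suc (suc n)) = trans (zeroʳ _) (sym (zeroʳ _))

-- The binomial series (1 - a x²)^(-1/2) = invSqrtSeries a: it solves
-- (1 - a x²) y' = a x y, hence y² (1 - a x²) = 1.
module BinomialSeries {c ℓ} (R : CommutativeRing c ℓ) (inv : ℕ → CommutativeRing.Carrier R) (invP : IsNatInverse R inv) where
  open CommutativeRing R hiding (zero)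
  open PowerSeries R
  open RatSeries R inv
  open SeriesRing R
  open Derivative R
  open Certificates R
  open Composition R
  open import Relation.Binary.Reasoning.Setoid setoid
  open import Data.Maybe using (Maybe; just; nothing)

  evenHalf-just : ∀ m n → evenHalf m ≡ just n → m ≡ n ℕ.+ n
  evenHalf-just zero n P.refl = P.refl
  evenHalf-just (suc zero) n ()
  evenHalf-just (suc (suc m)) n eq with evenHalf m in e
  evenHalf-just (suc (suc m)) .(suc n') P.refl | just n' =
    P.trans (P.cong (suc ∘ suc) (evenHalf-just m n' e)) (P.cong suc (P.sym (ℕP.+-suc n' n')))
  evenHalf-just (suc (suc m)) n () | nothing

  ½ : Carrier
  ½ = inv 1

  2·½ : (1# + 1#) * ½ ≈ 1#
  2·½ = trans (*-congʳ (+-congˡ (sym (+-identityʳ 1#)))) (invP 1)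

  binom : Carrier → Series
  binom = invSqrtSeries

  coefficient : Carrier → Maybe ℕ → Carrier
  coefficient a (just n) = gbinom (- ½) n * powR (- a) n
  coefficient a nothing = 0#

  binom-coefficient : ∀ a m → binom a m ≡ coefficient a (evenHalf m)
  binom-coefficient a m with evenHalf m
  ... | just n = P.refl
  ... | nothing = P.refl

  binom0 : ∀ a → binom a 0 ≈ 1#
  binom0 a = trans (*-identityʳ _) (*-identityʳ _)

  -- (m+2) y_{m+2} = a (m+1) y_m, from binom(-1/2, n+1) = binom(-1/2, n) (-1/2 - n)/(n+1)
  binom-recurrence : ∀ a m → fromℕ (suc (suc m)) * binom a (suc (suc m)) ≈ a * (fromℕ (suc m) * binom a m)
  binom-recurrence a m rewrite binom-coefficient a m | binom-coefficient a (suc (suc m)) with evenHalf m in e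
  ... | nothing = trans (zeroʳ _) (sym (trans (*-congˡ (zeroʳ _)) (zeroʳ _)))
  ... | just n rewrite evenHalf-just m n e = begin
      (1# + (1# + fromℕ (n ℕ.+ n))) * (((X1 * (- ½ - fromℕ n)) * (X2 * inv n)) * (- a * y))
        ≈⟨ *-congʳ (+-congˡ (+-congˡ (fromℕ-+ n n))) ⟩
      (1# + (1# + (f + f))) * (((X1 * (- ½ - f)) * (X2 * inv n)) * (- a * y))
        ≈⟨ certificate₂ ((1# + 1#) * (½ + f) * a * X1 * X2 * y) (a * X1 * X2 * y) identity (invP n) 2·½ ⟩
      a * ((1# + (f + f)) * ((X1 * X2) * y))
        ≈⟨ *-congˡ (*-congʳ (+-congˡ (sym (fromℕ-+ n n)))) ⟩
      a * ((1# + fromℕ (n ℕ.+ n)) * ((X1 * X2) * y)) ∎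
    where
    X1 X2 y f : Carrier
    X1 = Π< n (λ i → - ½ - fromℕ i)
    X2 = Π< n inv
    y = powR (- a) n
    f = fromℕ n
    open IntegerSolver R
    identity : (1# + (1# + (f + f))) * (((X1 * (- ½ - f)) * (X2 * inv n)) * (- a * y)) ≈
               a * ((1# + (f + f)) * ((X1 * X2) * y)) +
               (((1# + 1#) * (½ + f) * a * X1 * X2 * y) * ((1# + f) * inv n - 1#) + (a * X1 * X2 * y) * ((1# + 1#) * ½ - 1#))
    identity = solve 7 (λ X1 X2 y f h i a →
      (con (+ 1) :+ (con (+ 1) :+ (f :+ f))) :* (((X1 :* (:- h :- f)) :* (X2 :* i)) :* (:- a :* y)) :=
      a :* ((con (+ 1) :+ (f :+ f)) :* ((X1 :* X2) :* y)) :+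
      ((con (+ 2) :* (h :+ f) :* a :* X1 :* X2 :* y) :* ((con (+ 1) :+ f) :* i :- con (+ 1)) :+ (a :* X1 :* X2 :* y) :* (con (+ 2) :* h :- con (+ 1))))
      refl X1 X2 y f ½ (inv n) a

  quadratic : Carrier → Series
  quadratic a = one +ₛ (-ₛ (C a *ₛ (X *ₛ X)))

  binom-ode : ∀ a → (quadratic a *ₛ deriv (binom a)) ≈ₛ ((C a *ₛ X) *ₛ binom a)
  binom-ode a n = begin
    (quadratic a *ₛ y') n                    ≈⟨ expand n ⟩
    y' n + - (C a *ₛ (X *ₛ (X *ₛ y'))) n     ≈⟨ +-congˡ (-‿cong (CMul a (X *ₛ (X *ₛ y')) n)) ⟩
    y' n - a * (X *ₛ (X *ₛ y')) n            ≈⟨ coefficientwise n ⟩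
    a * (X *ₛ binom a) n                     ≈⟨ sym (CMul a (X *ₛ binom a) n) ⟩
    (C a *ₛ (X *ₛ binom a)) n                ≈⟨ S.sym (S.*-assoc (C a) X (binom a)) n ⟩
    ((C a *ₛ X) *ₛ binom a) n                ∎
    where
    y' : Series
    y' = deriv (binom a)
    expand : (quadratic a *ₛ y') ≈ₛ (y' +ₛ (-ₛ (C a *ₛ (X *ₛ (X *ₛ y')))))
    expand = solve 3 (λ ca x y → (con (+ 1) :+ (:- (ca :* (x :* x)))) :* y := y :+ (:- (ca :* (x :* (x :* y))))) S.refl (C a) X y'
      where open IntegerSolver SR
    -- y'_n - a (n-1) y_{n-1} = a y_{n-1}, i.e. the recurrence
    coefficientwise : ∀ n → y' n - a * (X *ₛ (X *ₛ y')) n ≈ a * (X *ₛ binom a) n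
    coefficientwise zero = begin
      y' 0 - a * (X *ₛ (X *ₛ y')) 0   ≈⟨ +-cong (trans (*-congˡ (reflexive (binom-coefficient a 1))) (zeroʳ _)) (-‿cong (trans (*-congˡ (Xmul0 (X *ₛ y'))) (zeroʳ _))) ⟩
      0# - 0#                         ≈⟨ -‿inverseʳ _ ⟩
      0#                              ≈⟨ sym (trans (*-congˡ (Xmul0 (binom a))) (zeroʳ _)) ⟩
      a * (X *ₛ binom a) 0            ∎
    coefficientwise (suc zero) = begin
      y' 1 - a * (X *ₛ (X *ₛ y')) 1   ≈⟨ +-cong (binom-recurrence a 0) (-‿cong (trans (*-congˡ (trans (XmulS (X *ₛ y') 0) (Xmul0 y'))) (zeroʳ _))) ⟩
      a * (fromℕ 1 * binom a 0) - 0#  ≈⟨ trans (+-congˡ -0#≈0#) (+-identityʳ _) ⟩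
      a * (fromℕ 1 * binom a 0)       ≈⟨ *-congˡ (trans (*-congʳ (+-identityʳ _)) (*-identityˡ _)) ⟩
      a * binom a 0                   ≈⟨ sym (*-congˡ (XmulS (binom a) 0)) ⟩
      a * (X *ₛ binom a) 1            ∎
      where open import Algebra.Properties.Ring ring using (-0#≈0#)
    coefficientwise (suc (suc m)) = begin
      y' (suc (suc m)) - a * (X *ₛ (X *ₛ y')) (suc (suc m))
        ≈⟨ +-cong (binom-recurrence a (suc m)) (-‿cong (*-congˡ (trans (XmulS (X *ₛ y') (suc m)) (XmulS y' m)))) ⟩
      a * ((1# + fromℕ (suc m)) * binom a (suc m)) - a * (fromℕ (suc m) * binom a (suc m))
        ≈⟨ cancel a (fromℕ (suc m)) (binom a (suc m)) ⟩
      a * binom a (suc m)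
        ≈⟨ sym (*-congˡ (XmulS (binom a) (suc m))) ⟩
      a * (X *ₛ binom a) (suc (suc m)) ∎
      where
      open IntegerSolver R
      cancel : ∀ a f x → a * ((1# + f) * x) - a * (f * x) ≈ a * x
      cancel = solve 3 (λ a f x → a :* ((con (+ 1) :+ f) :* x) :- a :* (f :* x) := a :* x) refl

  -- y² (1 - a x²) has derivative 2 y ((1 - a x²) y' - a x y) = 0 and constant term 1
  binom-square : ∀ a → ((binom a *ₛ binom a) *ₛ quadratic a) ≈ₛ one
  binom-square a = D-injective inv invP F one F0 DF
    where
    y y' Ca F : Series
    y = binom a
    y' = deriv y
    Ca = C a
    F = (y *ₛ y) *ₛ quadratic a
    Dquadratic : deriv (quadratic a) ≈ₛ (0ₛ +ₛ (-ₛ ((0ₛ *ₛ (X *ₛ X)) +ₛ (Ca *ₛ ((one *ₛ X) +ₛ (X *ₛ one))))))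
    Dquadratic = S.trans (D-+ one (-ₛ (Ca *ₛ (X *ₛ X)))) (S.+-cong D-one (S.trans (D-neg (Ca *ₛ (X *ₛ X))) (S.-‿cong
            (S.trans (leibniz Ca (X *ₛ X)) (S.+-cong (S.*-cong (D-C a) (S.refl {X *ₛ X}))
              (S.*-cong (S.refl {Ca}) (S.trans (leibniz X X) (S.+-cong (S.*-cong D-X (S.refl {X})) (S.*-cong (S.refl {X}) D-X)))))))))
    DF : deriv F ≈ₛ deriv one
    DF = S.trans (leibniz (y *ₛ y) (quadratic a))
          (S.trans (S.+-cong (S.*-cong (leibniz y y) (S.refl {quadratic a})) (S.*-cong (S.refl {y *ₛ y}) Dquadratic))
          (S.trans (Certificates.certificate₁ SR (y +ₛ y) identity (binom-ode a)) (S.sym D-one)))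
      where
      open IntegerSolver SR
      identity : ((((y' *ₛ y) +ₛ (y *ₛ y')) *ₛ quadratic a) +ₛ ((y *ₛ y) *ₛ (0ₛ +ₛ (-ₛ ((0ₛ *ₛ (X *ₛ X)) +ₛ (Ca *ₛ ((one *ₛ X) +ₛ (X *ₛ one))))))))
                 ≈ₛ (0ₛ +ₛ ((y +ₛ y) *ₛ ((quadratic a *ₛ y') +ₛ (-ₛ ((Ca *ₛ X) *ₛ y)))))
      identity = solve 4 (λ y' y ca x →
        ((y' :* y :+ y :* y') :* (con (+ 1) :+ (:- (ca :* (x :* x))))) :+ ((y :* y) :* (con (+ 0) :+ (:- ((con (+ 0) :* (x :* x)) :+ (ca :* ((con (+ 1) :* x) :+ (x :* con (+ 1))))))))
        := con (+ 0) :+ ((y :+ y) :* (((con (+ 1) :+ (:- (ca :* (x :* x)))) :* y') :+ (:- ((ca :* x) :* y))))) S.refl y' y Ca X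
    F0 : F 0 ≈ one 0
    F0 = begin
      F 0                                  ≈⟨ mul0 (y *ₛ y) (quadratic a) ⟩
      (y *ₛ y) 0 * quadratic a 0           ≈⟨ *-cong (trans (mul0 y y) (*-cong (binom0 a) (binom0 a))) (+-congˡ (-‿cong (trans (CMul a (X *ₛ X) 0) (trans (*-congˡ (Xmul0 X)) (zeroʳ _))))) ⟩
      (1# * 1#) * (1# + - 0#)              ≈⟨ solve 0 (con (+ 1) :* con (+ 1) :* (con (+ 1) :+ (:- con (+ 0))) := con (+ 1)) refl ⟩
      1#                                   ∎
      where open IntegerSolver R

  binom-square-∘ : ∀ g → g 0 ≈ 0# → ∀ a →
    ((compose (binom a) g *ₛ compose (binom a) g) *ₛ (one +ₛ (-ₛ (C a *ₛ (g *ₛ g))))) ≈ₛ one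
  binom-square-∘ g g0 a =
    S.trans (S.sym (S.*-cong (compose-* (binom a) (binom a)) quadratic-∘))
      (S.trans (S.sym (compose-* (binom a *ₛ binom a) (quadratic a)))
        (S.trans (compose-cong (binom-square a) (S.refl {g})) compose-one))
    where
    open Substitution g g0
    quadratic-∘ : compose (quadratic a) g ≈ₛ (one +ₛ (-ₛ (C a *ₛ (g *ₛ g))))
    quadratic-∘ = S.trans (compose-+ one (-ₛ (C a *ₛ (X *ₛ X))) g)
      (S.+-cong compose-one (S.trans (compose-neg (C a *ₛ (X *ₛ X)) g) (S.-‿cong
        (S.trans (compose-Cmul a (X *ₛ X) g) (S.*-cong (S.refl {C a}) (S.trans (compose-* X X) (S.*-cong compose-X compose-X)))))))

  D-radicand : ∀ a g → deriv (one +ₛ (-ₛ (C a *ₛ (g *ₛ g)))) ≈ₛ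
                       (0ₛ +ₛ (-ₛ ((0ₛ *ₛ (g *ₛ g)) +ₛ (C a *ₛ ((deriv g *ₛ g) +ₛ (g *ₛ deriv g))))))
  D-radicand a g = S.trans (D-+ one (-ₛ (C a *ₛ (g *ₛ g)))) (S.+-cong D-one (S.trans (D-neg (C a *ₛ (g *ₛ g))) (S.-‿cong
    (S.trans (leibniz (C a) (g *ₛ g)) (S.+-cong (S.*-cong (D-C a) (S.refl {g *ₛ g})) (S.*-cong (S.refl {C a}) (leibniz g g)))))))

  ThetaInv-derivative : ∀ k → deriv (ThetaInv k) ≈ₛ (binom 1# *ₛ binom (k * k))
  ThetaInv-derivative k n = trans (sym (*-assoc _ _ _)) (trans (*-congʳ (invP n)) (*-identityˡ _))

-- The polynomial identities behind the computation, valid in any commutative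
-- ring (they are applied in R[[x]]).  Here T stands for Θ, Q for Θ', and a, c
-- for 1 and k²; each is proved from its hypotheses by an explicit certificate.
module EllipticIdentities {c ℓ} (CR : CommutativeRing c ℓ) where
  open CommutativeRing CR
  open IntegerSolver CR
  open Certificates CR

  Rad : Carrier → Carrier → Carrier
  Rad a T = 1# - a * (T * T)

  -- the value of Θ'':  -(a T (1 - c T²) + c T (1 - a T²))
  E : Carrier → Carrier → Carrier → Carrier
  E a c T = - ((a * T) * Rad c T + (c * T) * Rad a T)

  D : Carrier → Carrier → Carrier → Carrier
  D a c T = 1# - (a * c) * ((T * T) * (T * T))

  -- the derivative of D (in terms of T and Q = T')
  D' : Carrier → Carrier → Carrier → Carrier → Carrier
  D' a c T Q = - ((a * c) * (((Q * T + T * Q) * (T * T)) + ((T * T) * (Q * T + T * Q))))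

  -- half the numerator of the derivative of 2 T Q / D
  B : Carrier → Carrier → Carrier → Carrier
  B a c T = Rad a T * Rad c T * D a c T + T * E a c T * D a c T + natR 4 * (a * c) * (T * T * (T * T)) * Rad a T * Rad c T

  module Polynomials {n : ℕ} where
    rad : Polynomial n → Polynomial n → Polynomial n
    rad a t = con (+ 1) :- a :* (t :* t)
    e d : Polynomial n → Polynomial n → Polynomial n → Polynomial n
    e a c t = :- ((a :* t) :* rad c t :+ (c :* t) :* rad a t)
    d a c t = con (+ 1) :- (a :* c) :* ((t :* t) :* (t :* t))
    d' : Polynomial n → Polynomial n → Polynomial n → Polynomial n → Polynomial n
    d' a c t q = :- ((a :* c) :* (((q :* t :+ t :* q) :* (t :* t)) :+ ((t :* t) :* (q :* t :+ t :* q))))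
    b : Polynomial n → Polynomial n → Polynomial n → Polynomial n
    b a c t = rad a t :* rad c t :* d a c t :+ t :* e a c t :* d a c t :+ con (+ 4) :* (a :* c) :* (t :* t :* (t :* t)) :* rad a t :* rad c t
  open Polynomials

  derivative-squared : ∀ α β Q a c T → α * β * Q ≈ 1# → α * α * Rad a T ≈ 1# → β * β * Rad c T ≈ 1# →
                       Q * Q ≈ Rad a T * Rad c T
  derivative-squared α β Q a c T =
    certificate₃ (Rad a T * Rad c T * (α * β * Q + 1#)) (- (Q * Q)) (- (Q * Q * α * α * Rad a T))
      (solve 6 (λ α β Q a c T →
         Q :* Q := rad a T :* rad c T
           :+ ((rad a T :* rad c T :* (α :* β :* Q :+ con (+ 1))) :* (α :* β :* Q :- con (+ 1))
           :+ ((:- (Q :* Q)) :* (α :* α :* rad a T :- con (+ 1))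
           :+ (:- (Q :* Q :* α :* α :* rad a T)) :* (β :* β :* rad c T :- con (+ 1)))))
         refl α β Q a c T)

  -- differentiating Q² = (1 - a T²)(1 - c T²) (the hypothesis, with the
  -- derivatives of the factors expanded) gives 2 Q (Q' - E) = 0
  second-derivative : ∀ Q Q' a c T →
    Q' * Q + Q * Q' ≈ (0# + - (0# * (T * T) + a * (Q * T + T * Q))) * Rad c T
                      + Rad a T * (0# + - (0# * (T * T) + c * (Q * T + T * Q))) →
    Q * ((1# + 1#) * (Q' - E a c T)) ≈ 0#
  second-derivative Q Q' a c T =
    certificate₁ 1#
      (solve 5 (λ Q Q' a c T →
         Q :* (con (+ 2) :* (Q' :- e a c T)) := con (+ 0)
           :+ con (+ 1) :* ((Q' :* Q :+ Q :* Q')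
                            :- ((con (+ 0) :+ :- (con (+ 0) :* (T :* T) :+ a :* (Q :* T :+ T :* Q))) :* rad c T
                                :+ rad a T :* (con (+ 0) :+ :- (con (+ 0) :* (T :* T) :+ c :* (Q :* T :+ T :* Q))))))
         refl Q Q' a c T)

  -- for g = T r with r = 1/Q:  g' Q² = D
  𝔗-derivative : ∀ Q Q' r r' g' a c T → g' ≈ Q * r + T * r' → Q * r ≈ 1# → Q' * r + Q * r' ≈ 0# →
                 Q * Q ≈ Rad a T * Rad c T → Q' ≈ E a c T → g' * (Q * Q) ≈ D a c T
  𝔗-derivative Q Q' r r' g' a c T =
    certificate₅ (Q * Q) (Q * Q - T * Q') (T * Q) 1# (- T)
      (solve 8 (λ Q Q' r r' g' a c T →
         g' :* (Q :* Q) := d a c T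
           :+ ((Q :* Q) :* (g' :- (Q :* r :+ T :* r'))
           :+ ((Q :* Q :- T :* Q') :* (Q :* r :- con (+ 1))
           :+ ((T :* Q) :* ((Q' :* r :+ Q :* r') :- con (+ 0))
           :+ (con (+ 1) :* (Q :* Q :- rad a T :* rad c T)
           :+ (:- T) :* (Q' :- e a c T))))))
         refl Q Q' r r' g' a c T)

  -- with s = 1/g' and R = 1/D:  (T r) s = T Q R, up to the factor Q D
  𝔗𝔗-difference : ∀ Q r s g' Dd R T → Q * r ≈ 1# → g' * s ≈ 1# → Dd * R ≈ 1# → g' * (Q * Q) ≈ Dd →
                  (Q * Dd) * ((T * r) * s - (T * Q) * R) ≈ 0#
  𝔗𝔗-difference Q r s g' Dd R T h₁ h₂ h₃ h₄ =
    certificate₄ (- (T * r * s * Q)) (T * Q * Q * (g' * s)) (T * Q * Q) (- (T * Q * Q))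
      (solve 7 (λ Q r s g' Dd R T →
         (Q :* Dd) :* ((T :* r) :* s :- (T :* Q) :* R) := con (+ 0)
           :+ ((:- (T :* r :* s :* Q)) :* (g' :* (Q :* Q) :- Dd)
           :+ ((T :* Q :* Q :* (g' :* s)) :* (Q :* r :- con (+ 1))
           :+ ((T :* Q :* Q) :* (g' :* s :- con (+ 1))
           :+ (:- (T :* Q :* Q)) :* (Dd :* R :- con (+ 1))))))
         refl Q r s g' Dd R T)
      h₄ h₁ h₂ h₃

  -- the derivative K' of K = 2 T Q R (R = 1/D) satisfies K' D² = 2 B
  duplicate-derivative : ∀ Q Q' R R' K' a c T →
      K' ≈ natR 2 * (Q * Q * R + T * Q' * R + T * Q * R') →
      D a c T * R ≈ 1# →
      D' a c T Q * R + D a c T * R' ≈ 0# →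
      Q * Q ≈ Rad a T * Rad c T → Q' ≈ E a c T →
      K' * (D a c T * D a c T) ≈ natR 2 * B a c T
  duplicate-derivative Q Q' R R' K' a c T =
    certificate₅ (D a c T * D a c T)
      (natR 2 * Q * Q * D a c T + natR 2 * T * Q' * D a c T - natR 2 * T * Q * D' a c T Q)
      (natR 2 * T * Q * D a c T)
      (natR 2 * D a c T + natR 8 * (a * c) * (T * T * (T * T)))
      (natR 2 * T * D a c T)
      (solve 8 (λ Q Q' R R' K' a c T →
         K' :* (d a c T :* d a c T) := con (+ 2) :* b a c T
           :+ ((d a c T :* d a c T) :* (K' :- con (+ 2) :* (Q :* Q :* R :+ T :* Q' :* R :+ T :* Q :* R'))
           :+ ((con (+ 2) :* Q :* Q :* d a c T :+ con (+ 2) :* T :* Q' :* d a c T :- con (+ 2) :* T :* Q :* d' a c T Q)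
                 :* (d a c T :* R :- con (+ 1))
           :+ ((con (+ 2) :* T :* Q :* d a c T) :* ((d' a c T Q :* R :+ d a c T :* R') :- con (+ 0))
           :+ ((con (+ 2) :* d a c T :+ con (+ 8) :* (a :* c) :* (T :* T :* (T :* T))) :* (Q :* Q :- rad a T :* rad c T)
           :+ (con (+ 2) :* T :* d a c T) :* (Q' :- e a c T))))))
         refl Q Q' R R' K' a c T)

  duplicate-times-D : ∀ T Q R Dd → Dd * R ≈ 1# → (((natR 2 * T) * Q) * R) * Dd ≈ natR 2 * T * Q
  duplicate-times-D T Q R Dd =
    certificate₁ (natR 2 * T * Q)
      (solve 4 (λ T Q R Dd →
         (((con (+ 2) :* T) :* Q) :* R) :* Dd := con (+ 2) :* T :* Q :+ (con (+ 2) :* T :* Q) :* (Dd :* R :- con (+ 1)))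
         refl T Q R Dd)

  -- the duplication identity: K = 2 T Q / D satisfies
  -- K'² = 4 (1 - a K²)(1 - c K²), after multiplying by D⁴
  duplication-ode : ∀ K K' Q a c T → K' * (D a c T * D a c T) ≈ natR 2 * B a c T → K * D a c T ≈ natR 2 * T * Q →
                    Q * Q ≈ Rad a T * Rad c T →
                    (D a c T * D a c T * (D a c T * D a c T)) * (K' * K' - natR 4 * Rad a K * Rad c K) ≈ 0#
  duplication-ode K K' Q a c T =
    certificate₃ (K' * (Dv * Dv) + natR 2 * B a c T) (- (natR 4 * (K * Dv + natR 2 * T * Q) * m)) (- (natR 16 * (T * T) * m))
      (solve 6 (λ K K' Q a c T →
         let dv = d a c T
             mm = :- (a :+ c) :* (dv :* dv) :+ (a :* c) :* ((K :* dv) :* (K :* dv) :+ con (+ 4) :* (T :* T) :* (rad a T :* rad c T))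
         in (dv :* dv :* (dv :* dv)) :* (K' :* K' :- con (+ 4) :* rad a K :* rad c K) := con (+ 0)
              :+ ((K' :* (dv :* dv) :+ con (+ 2) :* b a c T) :* (K' :* (dv :* dv) :- con (+ 2) :* b a c T)
              :+ ((:- (con (+ 4) :* (K :* dv :+ con (+ 2) :* T :* Q) :* mm)) :* (K :* dv :- con (+ 2) :* T :* Q)
              :+ (:- (con (+ 16) :* (T :* T) :* mm)) :* (Q :* Q :- rad a T :* rad c T))))
         refl K K' Q a c T)
    where
    Dv m : Carrier
    Dv = D a c T
    m = - (a + c) * (Dv * Dv) + (a * c) * ((K * Dv) * (K * Dv) + natR 4 * (T * T) * (Rad a T * Rad c T))

  root-of-four : ∀ α β K K' a c → α * α * Rad a K ≈ 1# → β * β * Rad c K ≈ 1# →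
                 K' * K' - natR 4 * Rad a K * Rad c K ≈ 0# →
                 (α * β * K' - natR 2) * (α * β * K' + natR 2) ≈ 0#
  root-of-four α β K K' a c =
    certificate₃ (natR 4 * (β * β * Rad c K)) (natR 4) (α * α * (β * β))
      (solve 6 (λ α β K K' a c →
         (α :* β :* K' :- con (+ 2)) :* (α :* β :* K' :+ con (+ 2)) := con (+ 0)
           :+ ((con (+ 4) :* (β :* β :* rad c K)) :* (α :* α :* rad a K :- con (+ 1))
           :+ ((con (+ 4)) :* (β :* β :* rad c K :- con (+ 1))
           :+ (α :* α :* (β :* β)) :* ((K' :* K' :- con (+ 4) :* rad a K :* rad c K) :- con (+ 0)))))
         refl α β K K' a c)

module Theta {c ℓ} (R : CommutativeRing c ℓ) (inv : ℕ → CommutativeRing.Carrier R) (invP : IsNatInverse R inv)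
             (k : CommutativeRing.Carrier R) (Θ : PowerSeries.Series R) (isΘ : RatSeries.IsTheta R inv k Θ) where
  open CommutativeRing R hiding (zero)
  open PowerSeries R
  open RatSeries R inv
  open SeriesRing R
  open Derivative R
  open Units R
  open Composition R
  open BinomialSeries R inv invP
  open Dilation R (1# + 1#)
  open import Relation.Binary.Reasoning.Setoid setoid
  open import Algebra.Properties.Group S.+-group using (x∙y⁻¹≈ε⇒x≈y)
  module Id = EllipticIdentities SR

  Θ0 : Θ 0 ≈ 0#
  Θ0 = proj₁ (proj₁ isΘ)

  module ΘSubst = Substitution Θ Θ0

  Θ1 : Θ 1 ≈ 1#
  Θ1 = proj₂ (proj₁ isΘ)

  Θ⁻¹ : Series
  Θ⁻¹ = ThetaInv k

  Θ⁻¹∘Θ : compose Θ⁻¹ Θ ≈ₛ X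
  Θ⁻¹∘Θ = proj₂ (proj₂ isΘ)

  -- the linear coefficient of Θ⁻¹ is the constant term of its derivative
  Θ⁻¹1 : Θ⁻¹ 1 ≈ 1#
  Θ⁻¹1 = trans (*-cong inv0 (trans (mul0 (binom 1#) (binom (k * k))) (*-cong (binom0 1#) (binom0 (k * k)))))
                (trans (*-identityˡ _) (*-identityˡ _))
    where
    inv0 : inv 0 ≈ 1#
    inv0 = trans (sym (*-identityˡ _)) (trans (*-congʳ (sym (+-identityʳ 1#))) (invP 0))

  C₁ Cₖ : Series
  C₁ = C 1#
  Cₖ = C (k * k)

  two : Series
  two = one +ₛ one

  D-two : deriv two ≈ₛ (0ₛ +ₛ 0ₛ)
  D-two = S.trans (D-+ one one) (S.+-cong D-one D-one)

  natRₛ : ℕ → Series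
  natRₛ = IntegerSolver.natR SR

  ≈ₛ-from-difference : ∀ {f g} → (f +ₛ (-ₛ g)) ≈ₛ 0ₛ → f ≈ₛ g
  ≈ₛ-from-difference {f} {g} = x∙y⁻¹≈ε⇒x≈y f g

  Θ′ Θ″ : Series
  Θ′ = deriv Θ
  Θ″ = deriv Θ′

  Θ′0 : Θ′ 0 ≈ 1#
  Θ′0 = trans (*-congʳ (+-identityʳ _)) (trans (*-identityˡ _) Θ1)

  -- differentiating Θ⁻¹ ∘ Θ = x by the chain rule: (Θ⁻¹)′(Θ) Θ′ = 1
  inverse-chain : ((compose (binom 1#) Θ *ₛ compose (binom (k * k)) Θ) *ₛ Θ′) ≈ₛ one
  inverse-chain =
    S.trans (S.*-cong (S.sym (S.trans (compose-cong (ThetaInv-derivative k) (S.refl {Θ})) (ΘSubst.compose-* (binom 1#) (binom (k * k)))))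
                      (S.refl {Θ′}))
            (S.trans (S.sym (ΘSubst.chain Θ⁻¹)) (S.trans (D-cong Θ⁻¹∘Θ) D-X))

  Θ′-squared : (Θ′ *ₛ Θ′) ≈ₛ (Id.Rad C₁ Θ *ₛ Id.Rad Cₖ Θ)
  Θ′-squared = Id.derivative-squared _ _ Θ′ C₁ Cₖ Θ inverse-chain (binom-square-∘ Θ Θ0 1#) (binom-square-∘ Θ Θ0 (k * k))

  -- Θ″ = -(Θ (1 - k² Θ²) + k² Θ (1 - Θ²)): differentiate Θ′-squared and
  -- cancel the series 2 Θ′, whose constant term 2 is a unit
  Θ″-formula : Θ″ ≈ₛ Id.E C₁ Cₖ Θ
  Θ″-formula = ≈ₛ-from-difference (unit-cancel two (Θ″ +ₛ (-ₛ Id.E C₁ Cₖ Θ)) ½ 2·½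
                 (unit-cancel Θ′ (two *ₛ (Θ″ +ₛ (-ₛ Id.E C₁ Cₖ Θ))) 1# (trans (*-identityʳ _) Θ′0)
                   (Id.second-derivative Θ′ Θ″ C₁ Cₖ Θ derivative-of-square)))
    where
    D-Rad : Series → Series
    D-Rad a = 0ₛ +ₛ (-ₛ ((0ₛ *ₛ (Θ *ₛ Θ)) +ₛ (a *ₛ ((Θ′ *ₛ Θ) +ₛ (Θ *ₛ Θ′)))))
    derivative-of-square : ((Θ″ *ₛ Θ′) +ₛ (Θ′ *ₛ Θ″)) ≈ₛ
      ((D-Rad C₁ *ₛ Id.Rad Cₖ Θ) +ₛ (Id.Rad C₁ Θ *ₛ D-Rad Cₖ))
    derivative-of-square = S.trans (S.sym (leibniz Θ′ Θ′)) (S.trans (D-cong Θ′-squared) (S.trans (leibniz (Id.Rad C₁ Θ) (Id.Rad Cₖ Θ))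
      (S.+-cong (S.*-cong (D-radicand 1# Θ) (S.refl {Id.Rad Cₖ Θ})) (S.*-cong (S.refl {Id.Rad C₁ Θ}) (D-radicand (k * k) Θ)))))

  -- 𝔗 Θ = Θ r with r = 1/Θ′
  r r′ 𝔗Θ′ : Series
  r = recip Θ′
  r′ = deriv r
  𝔗Θ′ = deriv (Θ *ₛ r)

  Θ′·r : (Θ′ *ₛ r) ≈ₛ one
  Θ′·r = recip-inverse Θ′ Θ′0

  Den Den⁻¹ Den⁻¹′ : Series
  Den = Id.D C₁ Cₖ Θ
  Den⁻¹ = recip Den
  Den⁻¹′ = deriv Den⁻¹

  Den0 : Den 0 ≈ 1#
  Den0 = trans (+-congˡ (-‿cong (trans (mul0 (C₁ *ₛ Cₖ) ((Θ *ₛ Θ) *ₛ (Θ *ₛ Θ))) (trans (*-congˡ Θ⁴0) (zeroʳ _)))))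
               (trans (+-congˡ -0#≈0#) (+-identityʳ _))
    where
    open import Algebra.Properties.Ring ring using (-0#≈0#)
    Θ⁴0 : ((Θ *ₛ Θ) *ₛ (Θ *ₛ Θ)) 0 ≈ 0#
    Θ⁴0 = trans (mul0 (Θ *ₛ Θ) (Θ *ₛ Θ)) (trans (*-congʳ (trans (mul0 Θ Θ) (trans (*-congʳ Θ0) (zeroˡ _)))) (zeroˡ _))

  Den·Den⁻¹ : (Den *ₛ Den⁻¹) ≈ₛ one
  Den·Den⁻¹ = recip-inverse Den Den0

  𝔗Θ′-formula : (𝔗Θ′ *ₛ (Θ′ *ₛ Θ′)) ≈ₛ Den
  𝔗Θ′-formula = Id.𝔗-derivative Θ′ Θ″ r r′ 𝔗Θ′ C₁ Cₖ Θ (leibniz Θ r) Θ′·r r-derivative Θ′-squared Θ″-formula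
    where
    r-derivative : ((Θ″ *ₛ r) +ₛ (Θ′ *ₛ r′)) ≈ₛ 0ₛ
    r-derivative = S.trans (S.sym (leibniz Θ′ r)) (S.trans (D-cong Θ′·r) D-one)

  𝔗Θ′0 : 𝔗Θ′ 0 ≈ 1#
  𝔗Θ′0 = trans (leibniz Θ r 0) (trans (+-cong (trans (mul0 Θ′ r) (trans (*-identityʳ _) Θ′0))
                                                (trans (mul0 Θ r′) (trans (*-congʳ Θ0) (zeroˡ _))))
                                       (+-identityʳ _))

  -- 𝔗 (𝔗 Θ) = Θ Θ′ / D, after cancelling the unit Θ′ D
  𝔗𝔗Θ : 𝔗 (𝔗 Θ) ≈ₛ ((Θ *ₛ Θ′) *ₛ Den⁻¹)
  𝔗𝔗Θ = ≈ₛ-from-difference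
    (unit-cancel (Θ′ *ₛ Den) (((Θ *ₛ r) *ₛ recip 𝔗Θ′) +ₛ (-ₛ ((Θ *ₛ Θ′) *ₛ Den⁻¹))) 1#
      (trans (*-identityʳ _) (trans (mul0 Θ′ Den) (trans (*-cong Θ′0 Den0) (*-identityʳ _))))
      (Id.𝔗𝔗-difference Θ′ r (recip 𝔗Θ′) 𝔗Θ′ Den Den⁻¹ Θ Θ′·r (recip-inverse 𝔗Θ′ 𝔗Θ′0) Den·Den⁻¹ 𝔗Θ′-formula))

  -- the candidate for Θ(2x)
  K K′ : Series
  K = ((two *ₛ Θ) *ₛ Θ′) *ₛ Den⁻¹
  K′ = deriv K

  K0 : K 0 ≈ 0#
  K0 = trans (mul0 ((two *ₛ Θ) *ₛ Θ′) Den⁻¹)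
             (trans (*-congʳ (trans (mul0 (two *ₛ Θ) Θ′) (trans (*-congʳ (trans (mul0 two Θ) (trans (*-congˡ Θ0) (zeroʳ _)))) (zeroˡ _))))
                    (zeroˡ _))

  K′-formula : K′ ≈ₛ (two *ₛ ((((Θ′ *ₛ Θ′) *ₛ Den⁻¹) +ₛ ((Θ *ₛ Θ″) *ₛ Den⁻¹)) +ₛ ((Θ *ₛ Θ′) *ₛ Den⁻¹′)))
  K′-formula = S.trans (leibniz ((two *ₛ Θ) *ₛ Θ′) Den⁻¹)
    (S.trans (S.+-cong (S.*-cong (S.trans (leibniz (two *ₛ Θ) Θ′)
                                   (S.+-cong (S.*-cong (S.trans (leibniz two Θ) (S.+-cong (S.*-cong D-two (S.refl {Θ})) (S.refl {two *ₛ Θ′})))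
                                                       (S.refl {Θ′}))
                                             (S.refl {(two *ₛ Θ) *ₛ Θ″})))
                                 (S.refl {Den⁻¹}))
                       (S.refl {((two *ₛ Θ) *ₛ Θ′) *ₛ Den⁻¹′}))
    (solve 5 (λ T Q Q' R R' →
      (((((con (+ 0) :+ con (+ 0)) :* T :+ con (+ 2) :* Q) :* Q) :+ (con (+ 2) :* T) :* Q') :* R) :+ ((con (+ 2) :* T) :* Q) :* R'
      := con (+ 2) :* (((Q :* Q) :* R :+ (T :* Q') :* R) :+ (T :* Q) :* R')) S.refl Θ Θ′ Θ″ Den⁻¹ Den⁻¹′))
    where open IntegerSolver SR

  D-Den : deriv Den ≈ₛ Id.D' C₁ Cₖ Θ Θ′
  D-Den = S.trans (D-+ one (-ₛ ((C₁ *ₛ Cₖ) *ₛ Θ⁴))) (S.trans (S.+-cong D-one (S.trans (D-neg ((C₁ *ₛ Cₖ) *ₛ Θ⁴)) (S.-‿cong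
            (S.trans (leibniz (C₁ *ₛ Cₖ) Θ⁴)
              (S.+-cong (S.*-cong (S.trans (leibniz C₁ Cₖ) (S.+-cong (S.*-cong (D-C 1#) (S.refl {Cₖ})) (S.*-cong (S.refl {C₁}) (D-C (k * k))))) (S.refl {Θ⁴}))
                        (S.*-cong (S.refl {C₁ *ₛ Cₖ}) (S.trans (leibniz (Θ *ₛ Θ) (Θ *ₛ Θ)) (S.+-cong (S.*-cong (leibniz Θ Θ) (S.refl {Θ *ₛ Θ})) (S.*-cong (S.refl {Θ *ₛ Θ}) (leibniz Θ Θ))))))))))
          (solve 5 (λ a c' T Q t4 →
            con (+ 0) :+ :- (((con (+ 0) :* c' :+ a :* con (+ 0)) :* t4) :+ (a :* c') :* (((Q :* T :+ T :* Q) :* (T :* T)) :+ ((T :* T) :* (Q :* T :+ T :* Q))))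
            := :- ((a :* c') :* (((Q :* T :+ T :* Q) :* (T :* T)) :+ ((T :* T) :* (Q :* T :+ T :* Q))))) S.refl C₁ Cₖ Θ Θ′ Θ⁴))
    where
    open IntegerSolver SR
    Θ⁴ : Series
    Θ⁴ = (Θ *ₛ Θ) *ₛ (Θ *ₛ Θ)

  -- K′² = 4 (1 - K²)(1 - k² K²), after cancelling the unit D⁴
  K-ode : ((K′ *ₛ K′) +ₛ (-ₛ ((natRₛ 4 *ₛ Id.Rad C₁ K) *ₛ Id.Rad Cₖ K))) ≈ₛ 0ₛ
  K-ode = unit-cancel ((Den *ₛ Den) *ₛ (Den *ₛ Den)) _ 1# D⁴0
            (Id.duplication-ode K K′ Θ′ C₁ Cₖ Θ K′·D² K·D Θ′-squared)
    where
    Den⁻¹-derivative : ((Id.D' C₁ Cₖ Θ Θ′ *ₛ Den⁻¹) +ₛ (Den *ₛ Den⁻¹′)) ≈ₛ 0ₛ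
    Den⁻¹-derivative = S.trans (S.+-cong (S.*-cong (S.sym D-Den) (S.refl {Den⁻¹})) (S.refl {Den *ₛ Den⁻¹′}))
                         (S.trans (S.sym (leibniz Den Den⁻¹)) (S.trans (D-cong Den·Den⁻¹) D-one))
    K′·D² : (K′ *ₛ (Den *ₛ Den)) ≈ₛ (natRₛ 2 *ₛ Id.B C₁ Cₖ Θ)
    K′·D² = Id.duplicate-derivative Θ′ Θ″ Den⁻¹ Den⁻¹′ K′ C₁ Cₖ Θ K′-formula Den·Den⁻¹ Den⁻¹-derivative Θ′-squared Θ″-formula
    K·D : (K *ₛ Den) ≈ₛ ((natRₛ 2 *ₛ Θ) *ₛ Θ′)
    K·D = Id.duplicate-times-D Θ Θ′ Den⁻¹ Den Den·Den⁻¹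
    D⁴0 : ((Den *ₛ Den) *ₛ (Den *ₛ Den)) 0 * 1# ≈ 1#
    D⁴0 = trans (*-identityʳ _) (trans (mul0 (Den *ₛ Den) (Den *ₛ Den)) (trans (*-cong D²0 D²0) (*-identityʳ _)))
      where
      D²0 : (Den *ₛ Den) 0 ≈ 1#
      D²0 = trans (mul0 Den Den) (trans (*-cong Den0 Den0) (*-identityʳ _))

  K′0 : K′ 0 ≈ 1# + 1#
  K′0 = begin
    K′ 0                                                              ≈⟨ K′-formula 0 ⟩
    (two *ₛ M) 0                                                      ≈⟨ trans (mul0 two M) (*-congˡ M0) ⟩
    (1# + 1#) * ((Θ′ 0 * Θ′ 0 * 1# + Θ 0 * Θ″ 0 * 1#) + Θ 0 * Θ′ 0 * Den⁻¹′ 0)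
      ≈⟨ certificate₂ (1# + 1# + (1# + 1#) * Θ′ 0) ((1# + 1#) * (Θ″ 0 + Θ′ 0 * Den⁻¹′ 0))
           (solve 4 (λ q t q' r' →
              con (+ 2) :* ((q :* q :* con (+ 1) :+ t :* q' :* con (+ 1)) :+ t :* q :* r')
                := con (+ 2) :+ ((con (+ 2) :+ con (+ 2) :* q) :* (q :- con (+ 1)) :+ (con (+ 2) :* (q' :+ q :* r')) :* (t :- con (+ 0))))
              refl (Θ′ 0) (Θ 0) (Θ″ 0) (Den⁻¹′ 0))
           Θ′0 Θ0 ⟩
    1# + 1#                                                           ∎
    where
    open IntegerSolver R
    open Certificates R
    M : Series
    M = (((Θ′ *ₛ Θ′) *ₛ Den⁻¹) +ₛ ((Θ *ₛ Θ″) *ₛ Den⁻¹)) +ₛ ((Θ *ₛ Θ′) *ₛ Den⁻¹′)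
    -- the constant term of Den⁻¹ is 1
    M0 : M 0 ≈ (Θ′ 0 * Θ′ 0 * 1# + Θ 0 * Θ″ 0 * 1#) + Θ 0 * Θ′ 0 * Den⁻¹′ 0
    M0 = +-cong (+-cong (trans (mul0 (Θ′ *ₛ Θ′) Den⁻¹) (*-congʳ (mul0 Θ′ Θ′)))
                        (trans (mul0 (Θ *ₛ Θ″) Den⁻¹) (*-congʳ (mul0 Θ Θ″))))
                (trans (mul0 (Θ *ₛ Θ′) Den⁻¹′) (*-congʳ (mul0 Θ Θ′)))

  -- (Θ⁻¹ ∘ K)′ = 2: its square is 4 by K-ode, and its constant term is 2
  -- (so the root -2 is excluded by cancelling the unit u + 2)
  Θ⁻¹∘K-derivative : deriv (compose Θ⁻¹ K) ≈ₛ two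
  Θ⁻¹∘K-derivative = S.trans (KSubst.chain Θ⁻¹)
    (S.trans (S.*-cong (S.trans (compose-cong (ThetaInv-derivative k) (S.refl {K})) (KSubst.compose-* (binom 1#) (binom (k * k))))
                       (S.refl {K′}))
             u≈2)
    where
    module KSubst = Substitution K K0
    u : Series
    u = (compose (binom 1#) K *ₛ compose (binom (k * k)) K) *ₛ K′
    u0 : u 0 ≈ 1# + 1#
    u0 = trans (mul0 (compose (binom 1#) K *ₛ compose (binom (k * k)) K) K′) (trans (*-cong (trans (mul0 (compose (binom 1#) K) (compose (binom (k * k)) K)) (*-cong (trans (compose0 (binom 1#) K) (binom0 1#))
                                                                                           (trans (compose0 (binom (k * k)) K) (binom0 (k * k)))))
                                         K′0)
                                 (trans (*-congʳ (*-identityʳ _)) (*-identityˡ _)))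
    u²≈4 : ((u +ₛ (-ₛ two)) *ₛ (u +ₛ two)) ≈ₛ 0ₛ
    u²≈4 = Id.root-of-four _ _ K K′ C₁ Cₖ (binom-square-∘ K K0 1#) (binom-square-∘ K K0 (k * k)) K-ode
    [u+2]0⁻¹ : (u 0 + (1# + 1#)) * inv 3 ≈ 1#
    [u+2]0⁻¹ = trans (*-congʳ (trans (+-congʳ u0) four)) (invP 3)
      where
      open IntegerSolver R
      four : (1# + 1#) + (1# + 1#) ≈ fromℕ 4
      four = solve 0 ((con (+ 1) :+ con (+ 1)) :+ (con (+ 1) :+ con (+ 1)) := con (+ 1) :+ (con (+ 1) :+ (con (+ 1) :+ (con (+ 1) :+ con (+ 0))))) refl
    u≈2 : u ≈ₛ two
    u≈2 = ≈ₛ-from-difference (unit-cancel (u +ₛ two) (u +ₛ (-ₛ two)) (inv 3) [u+2]0⁻¹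
                               (S.trans (S.*-comm (u +ₛ two) (u +ₛ (-ₛ two))) u²≈4))

  Θ⁻¹∘K : compose Θ⁻¹ K ≈ₛ (two *ₛ X)
  Θ⁻¹∘K = D-injective inv invP (compose Θ⁻¹ K) (two *ₛ X) constant-term (S.trans Θ⁻¹∘K-derivative (S.sym D-2x))
    where
    constant-term : compose Θ⁻¹ K 0 ≈ (two *ₛ X) 0
    constant-term = trans (compose0 Θ⁻¹ K) (sym (trans (mul0 two X) (zeroʳ _)))
    D-2x : deriv (two *ₛ X) ≈ₛ two
    D-2x = S.trans (leibniz two X) (S.trans (S.+-cong (S.*-cong D-two (S.refl {X}))
                                                     (S.*-cong (S.refl {two}) D-X))
                                   (solve 1 (λ x → (con (+ 0) :+ con (+ 0)) :* x :+ con (+ 2) :* con (+ 1) := con (+ 2)) S.refl X))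
      where
      open IntegerSolver SR

  -- and Θ⁻¹ ∘ Θ(2x) = 2x too, so K = Θ(2x)
  duplication : K ≈ₛ dilate Θ
  duplication = compose-cancelˡ Θ⁻¹ K (dilate Θ) Θ⁻¹1 K0 (trans (*-identityˡ _) Θ0) (S.trans Θ⁻¹∘K (S.sym Θ⁻¹∘dilate))
    where
    C2≈two : C (1# + 1#) ≈ₛ two
    C2≈two zero = refl
    C2≈two (suc n) = sym (+-identityʳ _)
    Θ⁻¹∘dilate : compose Θ⁻¹ (dilate Θ) ≈ₛ (two *ₛ X)
    Θ⁻¹∘dilate = S.trans (dilate-compose Θ⁻¹ Θ) (S.trans (dilate-cong Θ⁻¹∘Θ) (S.trans dilate-X (S.*-cong C2≈two (S.refl {X}))))

  halve : ((Θ *ₛ Θ′) *ₛ Den⁻¹) ≈ₛ (C ½ *ₛ K)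
  halve = S.sym (S.trans (regroup (C ½) Θ Θ′ Den⁻¹) (S.trans (S.*-cong ½·2 (S.refl {(Θ *ₛ Θ′) *ₛ Den⁻¹})) (S.*-identityˡ _)))
    where
    open IntegerSolver SR
    regroup : ∀ h t q r → (h *ₛ (((two *ₛ t) *ₛ q) *ₛ r)) ≈ₛ ((h *ₛ two) *ₛ ((t *ₛ q) *ₛ r))
    regroup = solve 4 (λ h t q r → h :* (((con (+ 2) :* t) :* q) :* r) := (h :* con (+ 2)) :* ((t :* q) :* r)) S.refl
    ½·2 : (C ½ *ₛ two) ≈ₛ one
    ½·2 zero = trans (CMul ½ two 0) (trans (*-comm _ _) 2·½)
    ½·2 (suc n) = trans (CMul ½ two (suc n)) (trans (*-congˡ (+-identityʳ _)) (zeroʳ _))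

theorem1p1 : ∀ {c ℓ} (R : CommutativeRing c ℓ) (inv : ℕ → CommutativeRing.Carrier R)
    → IsNatInverse R inv
    → (k : CommutativeRing.Carrier R) (Θ : PowerSeries.Series R)
    → RatSeries.IsTheta R inv k Θ
    → PowerSeries._≈ₛ_ R (PowerSeries.𝔗 R (PowerSeries.𝔗 R Θ)) (RatSeries.halfDilate R inv Θ)
theorem1p1 R inv invP k Θ isΘ n = begin
  𝔗 (𝔗 Θ) n                  ≈⟨ 𝔗𝔗Θ n ⟩
  ((Θ *ₛ Θ′) *ₛ Den⁻¹) n      ≈⟨ halve n ⟩
  (C ½ *ₛ K) n                ≈⟨ *ₛ-cong {C ½} {C ½} {K} {dilate Θ} ≈ₛ-refl duplication n ⟩
  (C ½ *ₛ dilate Θ) n         ≈⟨ CMul ½ (dilate Θ) n ⟩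
  ½ * dilate Θ n              ∎
  where
  open CommutativeRing R hiding (zero)
  open PowerSeries R
  open SeriesRing R
  open BinomialSeries R inv invP using (½)
  open Dilation R (1# + 1#) using (dilate)
  open Theta R inv invP k Θ isΘ
  open import Relation.Binary.Reasoning.Setoid setoid
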